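{- Fix a partition $\lambda\vdash k$ and $0\le h\le k$. For $r\ge2$ let $\sigma_r$ be a cycle of length $r$, let $P^{(r)}_\lambda$ be the polynomial with $P^{(r)}_\lambda(n)=\chi^{(n-k,\lambda)}(\sigma_r)$ for all $n\ge\max\{k+\lambda_1,r\}$, and write $P^{(r)}_\lambda(x)=\sum_{j=0}^{k}(-1)^j b^{(r)}_{\lambda,j}\binom{x-r}{k-j}$. Then for every $r>h$ (with $r\ge2$), $b^{(r)}_{\lambda,h}=f^{\lambda\setminus(1^h)}$; in particular the coefficients $b^{(r)}_{\lambda,h}$ stabilize as $r\to\infty$.
   Context: For $\mu\vdash n$, $\chi^\mu$ is the irreducible character of $S_n$ indexed by $\mu$; $(n-k,\lambda)$ is the partition of $n$ with first row $n-k$ followed by the rows of $\lambda$; $\lambda_1$ is the largest part of $\lambda$. An $r$-cycle in $S_r$ is viewed in $S_n$, $n\ge r$, via the standard embedding; $\chi^{(n-k,\lambda)}(\sigma_r)$ is, for large $n$, the value at $n$ of a polynomial of degree $k$ (taken as given). For partitions $\lambda,\nu$: if $\nu\subseteq\lambda$, $f^{\lambda\setminus\nu}$ is the number of standard Young tableaux of skew shape $\lambda\setminus\nu$ ($f^{\lambda\setminus\lambda}=1$), and $0$ otherwise; $f^{\lambda\setminus(1^h)}$ equals the number of standard Young tableaux of shape $\lambda$ in which $1,\dots,h$ occupy the first box of the first $h$ rows. -}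

module Defs where

open import Data.Nat using (_<?_; ℕ; zero; suc; _+_; _∸_; _⊓_; _≤_; _<_; _<ᵇ_; _≡ᵇ_)
open import Data.Nat.Combinatorics using (_C_)
open import Data.Nat.ListAction using (sum)
open import Data.Bool using (Bool; true; false; if_then_else_; _∧_)
open import Data.List using (List; []; _∷_; map; upTo; length; filter; concatMap; foldr; replicate)
open import Data.List.Relation.Unary.All using (All)
open import Data.List.Relation.Unary.Linked using (Linked)
open import Data.Integer using (ℤ; +_; -_) renaming (_+_ to _+ℤ_; _*_ to _*ℤ_)
open import Data.Product using (_×_)
open import Relation.Binary.PropositionalEquality using (_≡_)
open import Relation.Nullary.Decidable using (⌊_⌋)
open import Data.Nat.Properties using () renaming (_≟_ to _≟ℕ_)
open import Data.List.Properties using (≡-dec)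

IsPartition : List ℕ → Set
IsPartition p = Linked (λ a b → b ≤ a) p × All (λ a → 0 < a) p

_⊢_ : List ℕ → ℕ → Set
p ⊢ k = IsPartition p × sum p ≡ k

-- length of row i (rows beyond the last are empty, of length 0);
-- in particular  row p 0  is the largest part λ₁ (0 for the empty partition)
row : List ℕ → ℕ → ℕ
row []       _       = 0
row (x ∷ _)  zero    = x
row (_ ∷ xs) (suc i) = row xs i

pad : ℕ → List ℕ → List ℕ
pad L p = map (row p) (upTo L)

_==_ : List ℕ → List ℕ → Bool
p == q = ⌊ ≡-dec _≟ℕ_ p q ⌋

dec : ℕ → List ℕ → List ℕ
dec _       []       = []
dec zero    (x ∷ xs) = x ∸ 1 ∷ xs
dec (suc i) (x ∷ xs) = x ∷ dec i xs

-- A standard Young tableau of shape lam \ nu with m boxes is the same as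
-- a chain  nu = μ₀ ⊂ μ₁ ⊂ … ⊂ μₘ = lam  of partitions, each obtained from
-- the previous one by adding one box (the box containing the entry i).
-- chains m lam nu counts such chains of length m, by removing the box
-- with the largest entry (an outer corner of lam not in nu).

chains : ℕ → List ℕ → List ℕ → ℕ
chains zero    lam nu = if lam == nu then 1 else 0
chains (suc m) lam nu =
  sum (map (λ i → if (row lam (suc i) <ᵇ row lam i) ∧ (row nu i <ᵇ row lam i)
                  then chains m (dec i lam) nu else 0)
           (upTo (length lam)))

-- f^{lam \ nu}: number of SYT of skew shape lam \ nu if nu ⊆ lam, and 0 otherwise
-- (f^{lam \ lam} = 1).
fskew : List ℕ → List ℕ → ℕ
fskew lam nu = chains (sum lam ∸ sum nu) (pad L lam) (pad L nu)
  where L = length lam + length nu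

fshape : List ℕ → ℕ
fshape lam = fskew lam []

subsB : ℕ → List ℕ → List (List ℕ)
subsB b []      = [] ∷ []
subsB b (m ∷ mu) = concatMap (λ a → map (a ∷_) (subsB a mu)) (upTo (suc (b ⊓ m)))

subs : List ℕ → List (List ℕ)
subs mu = subsB (row mu 0) mu

stripRows : List ℕ → List ℕ → List ℕ
stripRows mu rho = filter (λ i → row rho i <? row mu i) (upTo (length mu))

-- the skew shape mu \ rho (rho ⊆ mu) is connected and contains no 2×2 square
-- iff its nonempty rows are consecutive and any two consecutive nonempty rows
-- i, i+1 share exactly one column, i.e.  rho_i + 1 = mu_{i+1}.
stripOK : List ℕ → List ℕ → List ℕ → Bool
stripOK mu rho (i ∷ j ∷ rest) = (j ≡ᵇ suc i) ∧ (suc (row rho i) ≡ᵇ row mu j) ∧ stripOK mu rho (j ∷ rest)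
stripOK mu rho _              = true

isBorderStrip : List ℕ → List ℕ → Bool
isBorderStrip mu rho = stripOK mu rho (stripRows mu rho)

height : List ℕ → List ℕ → ℕ
height mu rho = length (stripRows mu rho) ∸ 1

negOnePow : ℕ → ℤ
negOnePow zero    = + 1
negOnePow (suc j) = - negOnePow j

sumℤ : List ℤ → ℤ
sumℤ = foldr _+ℤ_ (+ 0)

-- χ^mu(σ_r), the irreducible character of S_n (n = |mu|) indexed by mu at an
-- r-cycle (cycle type (r,1^{n-r})), via the Murnaghan–Nakayama rule:
--   χ^mu(σ_r) = Σ_{border strips ξ ⊆ mu, |ξ| = r} (-1)^{ht ξ} f^{mu \ ξ}.
chiCycle : List ℕ → ℕ → ℤ
chiCycle mu r =
  sumℤ (map (λ rho → if (sum rho + r ≡ᵇ sum mu) ∧ isBorderStrip mu rho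
                     then negOnePow (height mu rho) *ℤ (+ fshape rho) else + 0)
            (subs mu))

binomExpansion : ℕ → ℕ → (ℕ → ℤ) → ℕ → ℤ
binomExpansion k r b n =
  sumℤ (map (λ j → negOnePow j *ℤ (b j *ℤ (+ ((n ∸ r) C (k ∸ j))))) (upTo (suc k)))

-- For a = n − k ≥ λ₁ + r, the Murnaghan–Nakayama rule sees only two kinds of r-border strips of
-- (a, λ): the last r boxes of the first row, contributing f^{(a − r, λ)}, and strips ξ inside λ,
-- contributing ± f^{(a, λ ∖ ξ)}. Expanding the Aitken determinant of f^{(a, ρ)} along its first row
-- gives f^{(a, ρ)} = Σ_m (−1)^m f^{ρ ∖ (1^m)} C(a + |ρ|, |ρ| − m); this is proved by induction on the
-- size of the skew shape, both sides obeying the recursion over the box holding the entry 1 thanks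
-- to Pascal's rule. With x = n − r the character is thus Σ_m (−1)^m f^{λ ∖ (1^m)} C(x, k − m) plus
-- multiples of C(x, d) with d ≤ k − r < k − h. The functions C(·, d) are linearly independent on every
-- tail of ℕ, so comparing coefficients of C(x, k − h) gives b_h = f^{λ ∖ (1^h)}.

module Submission where

open import Defs
open import Data.Nat using (ℕ; _+_; _∸_; _≤_; _<_)
open import Data.List using (List; _∷_; replicate)
open import Data.Integer using (ℤ; +_)
open import Relation.Binary.PropositionalEquality using (_≡_)
open import Algebra.Core using (Op₂)
open import Algebra.Structures using (IsCommutativeSemiring)
open import Data.Bool using (Bool; true; false; if_then_else_; _∧_)
open import Data.Bool.Properties using (T-≡; ∧-zeroʳ)
open import Data.Empty using (⊥-elim)
open import Data.Integer using (-_) renaming (_+_ to _+ℤ_; _*_ to _*ℤ_)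
import Data.Integer.Properties as ℤ
open import Algebra.Properties.AbelianGroup ℤ.+-0-abelianGroup using (∙-cancelˡ; identityˡ-unique; x∙y⁻¹≈ε⇒x≈y)
open import Data.List using ([]; _++_; length; map; concatMap; filter; upTo; applyUpTo; foldr)
open import Data.List.Properties
  using (≡-dec; length-++; length-replicate; length-map; ++-assoc; map-applyUpTo; map-++; map-∘; map-cong;
         filter-accept; filter-reject; filter-some; filter-none)
open import Data.List.Relation.Unary.All using (All; []; _∷_; universal) renaming (map to All-map)
import Data.List.Relation.Unary.All.Properties as All
open import Data.List.Relation.Unary.Any.Properties using (applyUpTo⁺)
open import Data.List.Relation.Unary.Linked using (Linked; []; [-]; _∷_)
open import Data.Nat
open import Data.Nat.Properties
open import Data.Nat.Combinatorics using (_C_; k>n⇒nCk≡0; nCk+nC[k+1]≡[n+1]C[k+1])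
open import Data.Nat.ListAction using (sum)
open import Data.Nat.ListAction.Properties using (sum-++)
open import Data.Product using (Σ; _×_; _,_; proj₂)
open import Function using (_∘_)
open import Function.Bundles using (Equivalence)
open import Relation.Binary.PropositionalEquality
open import Relation.Nullary using (Dec; yes; no)
open import Relation.Nullary.Decidable using (dec-true; dec-false; isYes≗does)

punchIn : ℕ → ℕ → ℕ
punchIn zero    k       = suc k
punchIn (suc m) zero    = zero
punchIn (suc m) (suc k) = suc (punchIn m k)

punchIn-< : ∀ m k → k < m → punchIn m k ≡ k
punchIn-< (suc m) zero    _         = refl
punchIn-< (suc m) (suc k) (s<s k<m) = cong suc (punchIn-< m k k<m)

punchIn-≥ : ∀ m k → m ≤ k → punchIn m k ≡ suc k
punchIn-≥ zero    k       _         = refl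
punchIn-≥ (suc m) (suc k) (s≤s m≤k) = cong suc (punchIn-≥ m k m≤k)

module RangeSum {A : Set} {_⊕_ _⊛_ : Op₂ A} {0# 1# : A}
                (isCommutativeSemiring : IsCommutativeSemiring _≡_ _⊕_ _⊛_ 0# 1#) where

  open IsCommutativeSemiring isCommutativeSemiring using () renaming
    (+-assoc to ⊕-assoc; +-comm to ⊕-comm; +-identityˡ to ⊕-identityˡ; +-identityʳ to ⊕-identityʳ;
     zeroʳ to ⊛-zeroʳ; distribˡ to ⊛-distribˡ-⊕)
  open ≡-Reasoning

  ∑ : ℕ → (ℕ → A) → A
  ∑ zero    f = 0#
  ∑ (suc n) f = f 0 ⊕ ∑ n (λ i → f (suc i))

  foldr-applyUpTo : ∀ n (f : ℕ → A) (g : ℕ → ℕ) → foldr _⊕_ 0# (map f (applyUpTo g n)) ≡ ∑ n (λ i → f (g i))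
  foldr-applyUpTo zero    f g = refl
  foldr-applyUpTo (suc n) f g = cong (f (g 0) ⊕_) (foldr-applyUpTo n f (λ i → g (suc i)))

  ∑-cong : ∀ n {f g : ℕ → A} → (∀ i → i < n → f i ≡ g i) → ∑ n f ≡ ∑ n g
  ∑-cong zero    f≗g = refl
  ∑-cong (suc n) f≗g = cong₂ _⊕_ (f≗g 0 z<s) (∑-cong n (λ i i<n → f≗g (suc i) (s<s i<n)))

  ∑-zero : ∀ n {f : ℕ → A} → (∀ i → i < n → f i ≡ 0#) → ∑ n f ≡ 0#
  ∑-zero zero    f≗0 = refl
  ∑-zero (suc n) f≗0 = trans (cong₂ _⊕_ (f≗0 0 z<s) (∑-zero n (λ i i<n → f≗0 (suc i) (s<s i<n))))
                             (⊕-identityʳ 0#)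

  ∑-distrib-⊕ : ∀ n (f g : ℕ → A) → ∑ n (λ i → f i ⊕ g i) ≡ ∑ n f ⊕ ∑ n g
  ∑-distrib-⊕ zero    f g = sym (⊕-identityʳ 0#)
  ∑-distrib-⊕ (suc n) f g = begin
    (f 0 ⊕ g 0) ⊕ ∑ n (λ i → f (suc i) ⊕ g (suc i))  ≡⟨ cong ((f 0 ⊕ g 0) ⊕_) (∑-distrib-⊕ n _ _) ⟩
    (f 0 ⊕ g 0) ⊕ (F ⊕ G)                           ≡⟨ ⊕-assoc (f 0) (g 0) (F ⊕ G) ⟩
    f 0 ⊕ (g 0 ⊕ (F ⊕ G))                           ≡⟨ cong (f 0 ⊕_) (sym (⊕-assoc (g 0) F G)) ⟩
    f 0 ⊕ ((g 0 ⊕ F) ⊕ G)                           ≡⟨ cong (λ x → f 0 ⊕ (x ⊕ G)) (⊕-comm (g 0) F) ⟩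
    f 0 ⊕ ((F ⊕ g 0) ⊕ G)                           ≡⟨ cong (f 0 ⊕_) (⊕-assoc F (g 0) G) ⟩
    f 0 ⊕ (F ⊕ (g 0 ⊕ G))                           ≡⟨ sym (⊕-assoc (f 0) F (g 0 ⊕ G)) ⟩
    (f 0 ⊕ F) ⊕ (g 0 ⊕ G)                           ∎
    where
    F = ∑ n (λ i → f (suc i))
    G = ∑ n (λ i → g (suc i))

  ∑-swap : ∀ n m (f : ℕ → ℕ → A) → ∑ n (λ i → ∑ m (f i)) ≡ ∑ m (λ j → ∑ n (λ i → f i j))
  ∑-swap zero    m f = sym (∑-zero m (λ _ _ → refl))
  ∑-swap (suc n) m f = trans (cong (∑ m (f 0) ⊕_) (∑-swap n m (λ i → f (suc i))))
                             (sym (∑-distrib-⊕ m (f 0) (λ j → ∑ n (λ i → f (suc i) j))))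

  ⊛-distribˡ-∑ : ∀ n c (f : ℕ → A) → ∑ n (λ i → c ⊛ f i) ≡ c ⊛ ∑ n f
  ⊛-distribˡ-∑ zero    c f = sym (⊛-zeroʳ c)
  ⊛-distribˡ-∑ (suc n) c f = trans (cong ((c ⊛ f 0) ⊕_) (⊛-distribˡ-∑ n c (λ i → f (suc i))))
                           (sym (⊛-distribˡ-⊕ c (f 0) _))

  ∑-if : ∀ b n (f : ℕ → A) → (if b then ∑ n f else 0#) ≡ ∑ n (λ i → if b then f i else 0#)
  ∑-if true  n f = refl
  ∑-if false n f = sym (∑-zero n (λ _ _ → refl))

  ∑-split : ∀ n p (f : ℕ → A) → ∑ (n + p) f ≡ ∑ n f ⊕ ∑ p (λ i → f (n + i))
  ∑-split zero    p f = sym (⊕-identityˡ _)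
  ∑-split (suc n) p f = trans (cong (f 0 ⊕_) (∑-split n p (λ i → f (suc i)))) (sym (⊕-assoc (f 0) _ _))

  ∑-punchIn : ∀ n m (f : ℕ → A) → m ≤ n → ∑ (suc n) f ≡ f m ⊕ ∑ n (λ i → f (punchIn m i))
  ∑-punchIn n       zero    f _         = refl
  ∑-punchIn (suc n) (suc m) f (s≤s m≤n) = begin
    f 0 ⊕ ∑ (suc n) (λ i → f (suc i))         ≡⟨ cong (f 0 ⊕_) (∑-punchIn n m (λ i → f (suc i)) m≤n) ⟩
    f 0 ⊕ (f (suc m) ⊕ R)                     ≡⟨ sym (⊕-assoc (f 0) _ _) ⟩
    (f 0 ⊕ f (suc m)) ⊕ R                     ≡⟨ cong (_⊕ R) (⊕-comm (f 0) (f (suc m))) ⟩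
    (f (suc m) ⊕ f 0) ⊕ R                     ≡⟨ ⊕-assoc (f (suc m)) _ _ ⟩
    f (suc m) ⊕ (f 0 ⊕ R)                     ∎
    where R = ∑ n (λ i → f (suc (punchIn m i)))

  ∑-single : ∀ n k {f : ℕ → A} → k < n → (∀ i → i < n → i ≢ k → f i ≡ 0#) → ∑ n f ≡ f k
  ∑-single (suc n) k {f} (s≤s k≤n) f≗0 = begin
    ∑ (suc n) f                        ≡⟨ ∑-punchIn n k f k≤n ⟩
    f k ⊕ ∑ n (λ i → f (punchIn k i))  ≡⟨ cong (f k ⊕_) (∑-zero n (λ i i<n → f≗0 _ (punchIn<1+n i<n) (punchIn≢ k i))) ⟩
    f k ⊕ 0#                           ≡⟨ ⊕-identityʳ (f k) ⟩
    f k                                ∎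
    where
    punchIn<1+n : ∀ {i} → i < n → punchIn k i < suc n
    punchIn<1+n {i} i<n with i <? k
    ... | yes i<k = subst (_< suc n) (sym (punchIn-< k i i<k)) (<-trans i<n ≤-refl)
    ... | no  i≮k = subst (_< suc n) (sym (punchIn-≥ k i (≮⇒≥ i≮k))) (s<s i<n)
    punchIn≢ : ∀ m i → punchIn m i ≢ m
    punchIn≢ zero    i       ()
    punchIn≢ (suc m) zero    ()
    punchIn≢ (suc m) (suc i) eq = punchIn≢ m i (suc-injective eq)

  ∑-pair : ∀ n p q {f : ℕ → A} → p < q → q ≤ n → (∀ i → i < suc n → i ≢ p → i ≢ q → f i ≡ 0#) →
           ∑ (suc n) f ≡ f p ⊕ f q
  ∑-pair n p q {f} p<q q≤n f≗0 = begin
    ∑ (suc n) f                        ≡⟨ ∑-punchIn n q f q≤n ⟩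
    f q ⊕ ∑ n (λ i → f (punchIn q i))  ≡⟨ cong (f q ⊕_) (∑-single n p (<-≤-trans p<q q≤n) g≗0) ⟩
    f q ⊕ f (punchIn q p)              ≡⟨ cong (λ i → f q ⊕ f i) (punchIn-< q p p<q) ⟩
    f q ⊕ f p                          ≡⟨ ⊕-comm (f q) (f p) ⟩
    f p ⊕ f q                          ∎
    where
    g≗0 : ∀ i → i < n → i ≢ p → f (punchIn q i) ≡ 0#
    g≗0 i i<n i≢p with i <? q
    ... | yes i<q = trans (cong f (punchIn-< q i i<q)) (f≗0 i (<-trans i<n ≤-refl) i≢p (λ i≡q → <-irrefl i≡q i<q))
    ... | no  i≮q = trans (cong f (punchIn-≥ q i (≮⇒≥ i≮q)))
                          (f≗0 (suc i) (s<s i<n)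
                               (λ i+1≡p → <-irrefl (sym i+1≡p) (<-≤-trans p<q (≤-trans (≮⇒≥ i≮q) (n≤1+n i))))
                               (λ i+1≡q → <-irrefl (sym i+1≡q) (s≤s (≮⇒≥ i≮q))))

open RangeSum +-*-isCommutativeSemiring using () renaming (∑ to ∑ℕ)
open RangeSum ℤ.+-*-isCommutativeSemiring using () renaming (∑ to ∑ℤ)
module ∑ℕ = RangeSum +-*-isCommutativeSemiring
module ∑ℤ = RangeSum ℤ.+-*-isCommutativeSemiring

+-∑ : ∀ n (f : ℕ → ℕ) → + ∑ℕ n f ≡ ∑ℤ n (λ i → + f i)
+-∑ zero    f = refl
+-∑ (suc n) f = trans (ℤ.pos-+ (f 0) _) (cong (+ f 0 +ℤ_) (+-∑ n (f ∘ suc)))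

<ᵇ≡true : ∀ {m n} → m < n → (m <ᵇ n) ≡ true
<ᵇ≡true {m} {n} = dec-true (m <? n)

<ᵇ≡true⇒< : ∀ {m n} → (m <ᵇ n) ≡ true → m < n
<ᵇ≡true⇒< {m} {n} eq = <ᵇ⇒< m n (Equivalence.from T-≡ eq)

≡ᵇ≡true : ∀ {m n} → m ≡ n → (m ≡ᵇ n) ≡ true
≡ᵇ≡true {m} {n} = dec-true (m ≟ n)

≡ᵇ≡false : ∀ {m n} → m ≢ n → (m ≡ᵇ n) ≡ false
≡ᵇ≡false {m} {n} = dec-false (m ≟ n)

==≡true : ∀ {l l′} → l ≡ l′ → (l == l′) ≡ true
==≡true {l} {l′} l≡l′ = trans (isYes≗does (≡-dec _≟_ l l′)) (dec-true (≡-dec _≟_ l l′) l≡l′)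

==≡false : ∀ {l l′} → l ≢ l′ → (l == l′) ≡ false
==≡false {l} {l′} l≢l′ = trans (isYes≗does (≡-dec _≟_ l l′)) (dec-false (≡-dec _≟_ l l′) l≢l′)

∧≡true : ∀ {a b : Bool} → (a ∧ b) ≡ true → (a ≡ true) × (b ≡ true)
∧≡true {true} {true} _ = refl , refl

if-zero : ∀ {A : Set} (b : Bool) {x z : A} → x ≡ z → (if b then x else z) ≡ z
if-zero true  x≡z = x≡z
if-zero false _   = refl

+-≡ᵇ-+ : ∀ a x y → (a + x ≡ᵇ a + y) ≡ (x ≡ᵇ y)
+-≡ᵇ-+ zero    x y = refl
+-≡ᵇ-+ (suc a) x y = +-≡ᵇ-+ a x y

Decreasing : List ℕ → Set
Decreasing l = ∀ i → row l (suc i) ≤ row l i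

_⊆_ : List ℕ → List ℕ → Set
mu ⊆ lam = ∀ i → row mu i ≤ row lam i

inc : ℕ → List ℕ → List ℕ
inc _       []       = []
inc zero    (x ∷ xs) = suc x ∷ xs
inc (suc i) (x ∷ xs) = x ∷ inc i xs

row-dec-≡ : ∀ i l → row (dec i l) i ≡ row l i ∸ 1
row-dec-≡ i       []      = refl
row-dec-≡ zero    (x ∷ l) = refl
row-dec-≡ (suc i) (x ∷ l) = row-dec-≡ i l

row-dec-≢ : ∀ i j l → i ≢ j → row (dec i l) j ≡ row l j
row-dec-≢ i       j       []      _   = refl
row-dec-≢ zero    zero    (x ∷ l) i≢j = ⊥-elim (i≢j refl)
row-dec-≢ zero    (suc j) (x ∷ l) _   = refl
row-dec-≢ (suc i) zero    (x ∷ l) _   = refl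
row-dec-≢ (suc i) (suc j) (x ∷ l) i≢j = row-dec-≢ i j l (i≢j ∘ cong suc)

row-dec-≤ : ∀ i j l → row (dec i l) j ≤ row l j
row-dec-≤ i j l with i ≟ j
... | yes refl = subst (_≤ row l i) (sym (row-dec-≡ i l)) (m∸n≤m _ 1)
... | no  i≢j  = ≤-reflexive (row-dec-≢ i j l i≢j)

row-inc-≡ : ∀ i l → i < length l → row (inc i l) i ≡ suc (row l i)
row-inc-≡ zero    (x ∷ l) _         = refl
row-inc-≡ (suc i) (x ∷ l) (s<s i<n) = row-inc-≡ i l i<n

row-inc-≢ : ∀ i j l → i ≢ j → row (inc i l) j ≡ row l j
row-inc-≢ i       j       []      _   = refl
row-inc-≢ zero    zero    (x ∷ l) i≢j = ⊥-elim (i≢j refl)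
row-inc-≢ zero    (suc j) (x ∷ l) _   = refl
row-inc-≢ (suc i) zero    (x ∷ l) _   = refl
row-inc-≢ (suc i) (suc j) (x ∷ l) i≢j = row-inc-≢ i j l (i≢j ∘ cong suc)

length-dec : ∀ i l → length (dec i l) ≡ length l
length-dec i       []      = refl
length-dec zero    (x ∷ l) = refl
length-dec (suc i) (x ∷ l) = cong suc (length-dec i l)

length-inc : ∀ i l → length (inc i l) ≡ length l
length-inc i       []      = refl
length-inc zero    (x ∷ l) = refl
length-inc (suc i) (x ∷ l) = cong suc (length-inc i l)

sum-inc : ∀ i l → i < length l → sum (inc i l) ≡ suc (sum l)
sum-inc zero    (x ∷ l) _         = refl
sum-inc (suc i) (x ∷ l) (s<s i<n) = trans (cong (_+_ x) (sum-inc i l i<n)) (+-suc x (sum l))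

dec-inc : ∀ i l → dec i (inc i l) ≡ l
dec-inc i       []      = refl
dec-inc zero    (x ∷ l) = refl
dec-inc (suc i) (x ∷ l) = cong (x ∷_) (dec-inc i l)

inc-dec : ∀ i l → 0 < row l i → inc i (dec i l) ≡ l
inc-dec zero    (suc x ∷ l) _ = refl
inc-dec (suc i) (x ∷ l)     p = cong (x ∷_) (inc-dec i l p)

row-≥length : ∀ l i → length l ≤ i → row l i ≡ 0
row-≥length []      i       _         = refl
row-≥length (x ∷ l) (suc i) (s≤s n≤i) = row-≥length l i n≤i

row-inc-≤ : ∀ k l j → row (inc k l) j ≤ suc (row l j)
row-inc-≤ k l j with k ≟ j
... | no  k≢j = ≤-trans (≤-reflexive (row-inc-≢ k j l k≢j)) (n≤1+n _)
... | yes refl with k <? length l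
...   | yes k<n = ≤-reflexive (row-inc-≡ k l k<n)
...   | no  k≮n = subst (_≤ suc (row l k)) (sym (row-≥length (inc k l) k (subst (_≤ k) (sym (length-inc k l)) (≮⇒≥ k≮n)))) z≤n

row-inc-≥ : ∀ k l j → row l j ≤ row (inc k l) j
row-inc-≥ k       []      j       = z≤n
row-inc-≥ zero    (x ∷ l) zero    = n≤1+n x
row-inc-≥ zero    (x ∷ l) (suc j) = ≤-refl
row-inc-≥ (suc k) (x ∷ l) zero    = ≤-refl
row-inc-≥ (suc k) (x ∷ l) (suc j) = row-inc-≥ k l j

Decreasing-dec : ∀ l j → Decreasing l → row l (suc j) < row l j → Decreasing (dec j l)
Decreasing-dec l j l↓ corner i with i ≟ j | suc i ≟ j
... | yes refl | _ = subst₂ _≤_ (sym (row-dec-≢ i (suc i) l (λ ()))) (sym (row-dec-≡ i l)) (pred-mono-≤ corner)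
... | no _ | yes refl = subst₂ _≤_ (sym (row-dec-≡ (suc i) l)) (sym (row-dec-≢ (suc i) i l (λ ())))
                                (≤-trans (m∸n≤m _ 1) (l↓ i))
... | no i≢j | no i+1≢j = subst₂ _≤_ (sym (row-dec-≢ j (suc i) l (i+1≢j ∘ sym))) (sym (row-dec-≢ j i l (i≢j ∘ sym))) (l↓ i)

Decreasing-inc : ∀ l k → Decreasing l → (∀ j → k ≡ suc j → row l k < row l j) → Decreasing (inc k l)
Decreasing-inc l k l↓ corner i with k ≟ suc i | k ≟ i
... | yes refl | _ = ≤-trans (row-inc-≤ (suc i) l (suc i))
                             (subst (suc (row l (suc i)) ≤_) (sym (row-inc-≢ (suc i) i l (λ ()))) (corner i refl))
... | no _ | yes refl = ≤-trans (≤-reflexive (row-inc-≢ i (suc i) l (λ ()))) (≤-trans (l↓ i) (row-inc-≥ i l i))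
... | no k≢i+1 | no k≢i = subst₂ _≤_ (sym (row-inc-≢ k (suc i) l k≢i+1)) (sym (row-inc-≢ k i l k≢i)) (l↓ i)

Decreasing-head : ∀ l → Decreasing l → ∀ j → row l j ≤ row l 0
Decreasing-head l l↓ zero    = ≤-refl
Decreasing-head l l↓ (suc j) = ≤-trans (l↓ j) (Decreasing-head l l↓ j)

Decreasing-cons : ∀ a l → Decreasing l → row l 0 ≤ a → Decreasing (a ∷ l)
Decreasing-cons a l l↓ head≤ zero    = head≤
Decreasing-cons a l l↓ head≤ (suc i) = l↓ i

Linked⇒Decreasing : ∀ {l} → Linked (λ a b → b ≤ a) l → Decreasing l
Linked⇒Decreasing []       i       = z≤n
Linked⇒Decreasing [-]      zero    = z≤n
Linked⇒Decreasing [-]      (suc i) = z≤n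
Linked⇒Decreasing (r ∷ rs) zero    = r
Linked⇒Decreasing (r ∷ rs) (suc i) = Linked⇒Decreasing rs i

inc-⊆ : ∀ mu lam k → mu ⊆ lam → row mu k < row lam k → inc k mu ⊆ lam
inc-⊆ mu lam k mu⊆ room i with k ≟ i
... | yes refl = ≤-trans (row-inc-≤ k mu k) room
... | no  k≢i  = subst (_≤ row lam i) (sym (row-inc-≢ k i mu k≢i)) (mu⊆ i)

sum-⊆ : ∀ mu lam → length mu ≡ length lam → mu ⊆ lam → sum mu ≤ sum lam
sum-⊆ []       []        _  _    = ≤-refl
sum-⊆ (x ∷ mu) (y ∷ lam) n≡ mu⊆ = +-mono-≤ (mu⊆ 0) (sum-⊆ mu lam (suc-injective n≡) (mu⊆ ∘ suc))

⊆-antisym-sum : ∀ mu lam → length mu ≡ length lam → mu ⊆ lam → sum lam ≤ sum mu → mu ≡ lam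
⊆-antisym-sum []       []        _  _    _ = refl
⊆-antisym-sum (x ∷ mu) (y ∷ lam) n≡ mu⊆ lam≤mu =
  cong₂ _∷_ (≤-antisym (mu⊆ 0) y≤x) (⊆-antisym-sum mu lam (suc-injective n≡) (mu⊆ ∘ suc) tail≥)
  where
  tail≤ : sum mu ≤ sum lam
  tail≤ = sum-⊆ mu lam (suc-injective n≡) (mu⊆ ∘ suc)
  y≤x : y ≤ x
  y≤x = +-cancelʳ-≤ (sum lam) y x (≤-trans lam≤mu (+-monoʳ-≤ x tail≤))
  tail≥ : sum lam ≤ sum mu
  tail≥ = +-cancelˡ-≤ y (sum lam) (sum mu) (≤-trans lam≤mu (+-monoˡ-≤ (sum mu) (mu⊆ 0)))

removable : List ℕ → List ℕ → ℕ → Bool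
removable lam mu i = (row lam (suc i) <ᵇ row lam i) ∧ (row mu i <ᵇ row lam i)

chains-top : ∀ m lam mu →
  chains (suc m) lam mu ≡ ∑ℕ (length lam) (λ i → if removable lam mu i then chains m (dec i lam) mu else 0)
chains-top m lam mu = ∑ℕ.foldr-applyUpTo (length lam) _ (λ i → i)

chains-⊈ : ∀ m lam mu i → row lam i < row mu i → chains m lam mu ≡ 0
chains-⊈ zero lam mu i lam<mu
  rewrite ==≡false {lam} {mu} (λ { refl → <-irrefl refl lam<mu }) = refl
chains-⊈ (suc m) lam mu i lam<mu = trans (chains-top m lam mu)
  (∑ℕ.∑-zero (length lam) (λ j _ → if-zero (removable lam mu j)
     (chains-⊈ m (dec j lam) mu i (≤-<-trans (row-dec-≤ j i lam) lam<mu))))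

chains-unsorted : ∀ m lam mu i → Decreasing lam → row mu i < row mu (suc i) → chains m lam mu ≡ 0
chains-unsorted zero lam mu i lam↓ mu↑ with ≡-dec _≟_ lam mu
... | yes refl = ⊥-elim (<-irrefl refl (<-≤-trans mu↑ (lam↓ i)))
... | no  _    = refl
chains-unsorted (suc m) lam mu i lam↓ mu↑ = trans (chains-top m lam mu) (∑ℕ.∑-zero (length lam) (λ j _ → term j))
  where
  term : ∀ j → (if removable lam mu j then chains m (dec j lam) mu else 0) ≡ 0
  term j with row lam (suc j) <ᵇ row lam j in corner
  ... | false = refl
  ... | true  = if-zero (row mu j <ᵇ row lam j)
                  (chains-unsorted m (dec j lam) mu i (Decreasing-dec lam j lam↓ (<ᵇ≡true⇒< corner)) mu↑)

removable-inc : ∀ mu i → Decreasing mu → i < length mu → removable (inc i mu) mu i ≡ true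
removable-inc mu i mu↓ i<n
  rewrite row-inc-≢ i (suc i) mu (λ ()) | row-inc-≡ i mu i<n
        | <ᵇ≡true {row mu (suc i)} {suc (row mu i)} (s≤s (mu↓ i))
        | <ᵇ≡true {row mu i} {suc (row mu i)} ≤-refl = refl

chains-one-bottom : ∀ lam mu i → Decreasing mu → i < length mu →
  (if removable lam mu i then chains 0 (dec i lam) mu else 0) ≡ chains 0 lam (inc i mu)
chains-one-bottom lam mu i mu↓ i<n with ≡-dec _≟_ lam (inc i mu)
... | yes refl rewrite removable-inc mu i mu↓ i<n | dec-inc i mu | ==≡true {mu} refl = refl
... | no lam≢ with removable lam mu i in rem
...   | false = refl
...   | true with ≡-dec _≟_ (dec i lam) mu
...     | no  _  = refl
...     | yes eq = ⊥-elim (lam≢ (trans (sym (inc-dec i lam 0<lamᵢ)) (cong (inc i) eq)))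
  where
  0<lamᵢ : 0 < row lam i
  0<lamᵢ = ≤-<-trans z≤n (<ᵇ≡true⇒< (proj₂ (∧≡true rem)))

-- The two guards differ only if i = k and lam i = suc (mu i); then dec i lam ⊉ inc i mu.
removable-inc-guard : ∀ m lam mu i k → i < length mu →
  (if removable lam mu i then chains m (dec i lam) (inc k mu) else 0)
  ≡ (if removable lam (inc k mu) i then chains m (dec i lam) (inc k mu) else 0)
removable-inc-guard m lam mu i k i<n with i ≟ k
... | no i≢k = cong (λ x → if (row lam (suc i) <ᵇ row lam i) ∧ (x <ᵇ row lam i) then chains m (dec i lam) (inc k mu) else 0)
                    (sym (row-inc-≢ k i mu (i≢k ∘ sym)))
... | yes refl with suc (row mu i) <? row lam i
...   | yes room = cong (λ b → if (row lam (suc i) <ᵇ row lam i) ∧ b then chains m (dec i lam) (inc i mu) else 0)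
                        (trans (<ᵇ≡true (<-trans ≤-refl room))
                               (sym (trans (cong (_<ᵇ row lam i) (row-inc-≡ i mu i<n)) (<ᵇ≡true room))))
...   | no  full = trans (if-zero (removable lam mu i) vanishes) (sym (if-zero (removable lam (inc i mu) i) vanishes))
  where
  vanishes : chains m (dec i lam) (inc i mu) ≡ 0
  vanishes = chains-⊈ m (dec i lam) (inc i mu) i
    (subst₂ _<_ (sym (row-dec-≡ i lam)) (sym (row-inc-≡ i mu i<n)) (s≤s (∸-monoˡ-≤ 1 (≮⇒≥ full))))

-- Removing the box with the smallest entry instead of the largest one: by induction on m, the two
-- removals commute.
chains-bottom : ∀ m lam mu → Decreasing mu → length mu ≡ length lam →
  chains (suc m) lam mu ≡ ∑ℕ (length mu) (λ k → chains m lam (inc k mu))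
chains-bottom zero lam mu mu↓ n≡ = trans (chains-top 0 lam mu)
  (trans (∑ℕ.∑-cong (length lam) (λ i i<n → chains-one-bottom lam mu i mu↓ (subst (i <_) (sym n≡) i<n)))
         (cong (λ n → ∑ℕ n (λ k → chains 0 lam (inc k mu))) (sym n≡)))
chains-bottom (suc m) lam mu mu↓ n≡ = begin
  chains (suc (suc m)) lam mu
    ≡⟨ chains-top (suc m) lam mu ⟩
  ∑ℕ L (λ i → if removable lam mu i then chains (suc m) (dec i lam) mu else 0)
    ≡⟨ ∑ℕ.∑-cong L (λ i _ → cong (λ x → if removable lam mu i then x else 0)
                              (chains-bottom m (dec i lam) mu mu↓ (trans n≡ (sym (length-dec i lam))))) ⟩
  ∑ℕ L (λ i → if removable lam mu i then ∑ℕ M (λ k → chains m (dec i lam) (inc k mu)) else 0)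
    ≡⟨ ∑ℕ.∑-cong L (λ i _ → ∑ℕ.∑-if (removable lam mu i) M _) ⟩
  ∑ℕ L (λ i → ∑ℕ M (λ k → if removable lam mu i then chains m (dec i lam) (inc k mu) else 0))
    ≡⟨ ∑ℕ.∑-cong L (λ i i<L → ∑ℕ.∑-cong M (λ k _ → removable-inc-guard m lam mu i k (subst (i <_) (sym n≡) i<L))) ⟩
  ∑ℕ L (λ i → ∑ℕ M (λ k → if removable lam (inc k mu) i then chains m (dec i lam) (inc k mu) else 0))
    ≡⟨ ∑ℕ.∑-swap L M _ ⟩
  ∑ℕ M (λ k → ∑ℕ L (λ i → if removable lam (inc k mu) i then chains m (dec i lam) (inc k mu) else 0))
    ≡⟨ ∑ℕ.∑-cong M (λ k _ → sym (chains-top m lam (inc k mu))) ⟩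
  ∑ℕ M (λ k → chains (suc m) lam (inc k mu)) ∎
  where
  open ≡-Reasoning
  L = length lam
  M = length mu

m∸n≡suc[m∸1+n] : ∀ {m n} → n < m → m ∸ n ≡ suc (m ∸ suc n)
m∸n≡suc[m∸1+n] {suc m} {zero}  _         = refl
m∸n≡suc[m∸1+n] {suc m} {suc n} (s<s n<m) = m∸n≡suc[m∸1+n] n<m

skewSize : List ℕ → List ℕ → ℕ
skewSize lam mu = sum lam ∸ sum mu

sytCount : List ℕ → List ℕ → ℕ
sytCount lam mu = chains (skewSize lam mu) lam mu

skewSize-inc : ∀ lam mu k n → k < length mu → skewSize lam mu ≡ suc n → skewSize lam (inc k mu) ≡ n
skewSize-inc lam mu k n k<n size≡ = begin
  sum lam ∸ sum (inc k mu)  ≡⟨ cong (sum lam ∸_) (sum-inc k mu k<n) ⟩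
  sum lam ∸ suc (sum mu)    ≡⟨ sym (pred[m∸n]≡m∸[1+n] (sum lam) (sum mu)) ⟩
  pred (skewSize lam mu)    ≡⟨ cong pred size≡ ⟩
  n                         ∎
  where open ≡-Reasoning

sytCount-bottom : ∀ lam mu → Decreasing mu → length mu ≡ length lam → sum mu < sum lam →
  sytCount lam mu ≡ ∑ℕ (length mu) (λ k → sytCount lam (inc k mu))
sytCount-bottom lam mu mu↓ n≡ mu<lam = begin
  chains (skewSize lam mu) lam mu
    ≡⟨ cong (λ s → chains s lam mu) size≡ ⟩
  chains (suc n) lam mu
    ≡⟨ chains-bottom n lam mu mu↓ n≡ ⟩
  ∑ℕ (length mu) (λ k → chains n lam (inc k mu))
    ≡⟨ ∑ℕ.∑-cong (length mu) (λ k k<n → cong (λ s → chains s lam (inc k mu)) (sym (skewSize-inc lam mu k n k<n size≡))) ⟩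
  ∑ℕ (length mu) (λ k → sytCount lam (inc k mu)) ∎
  where
  open ≡-Reasoning
  n = sum lam ∸ suc (sum mu)
  size≡ : skewSize lam mu ≡ suc n
  size≡ = m∸n≡suc[m∸1+n] mu<lam

sytCount-sum> : ∀ lam mu → sum lam < sum mu → sytCount lam mu ≡ 0
sytCount-sum> lam mu lam<mu rewrite m≤n⇒m∸n≡0 (<⇒≤ lam<mu) | ==≡false {lam} {mu} (λ { refl → <-irrefl refl lam<mu }) = refl

sytCount-refl : ∀ lam → sytCount lam lam ≡ 1
sytCount-refl lam rewrite n∸n≡0 (sum lam) | ==≡true {lam} refl = refl

sytCount-⊈ : ∀ lam mu i → row lam i < row mu i → sytCount lam mu ≡ 0
sytCount-⊈ lam mu = chains-⊈ (skewSize lam mu) lam mu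

sytCount-unsorted : ∀ lam mu i → Decreasing lam → row mu i < row mu (suc i) → sytCount lam mu ≡ 0
sytCount-unsorted lam mu = chains-unsorted (skewSize lam mu) lam mu

-- Expansion of the Aitken determinant along its first row

-- Deleting row 0 and column m of the Aitken determinant det [1 / (lamᵢ − muⱼ − i + j)!]
-- of f^{lam ∖ mu} leaves the Aitken determinant of (tail lam) ∖ (minorShape m mu).
minorShape : ℕ → List ℕ → List ℕ
minorShape _       []       = []
minorShape zero    (x ∷ xs) = xs
minorShape (suc m) (x ∷ xs) = suc x ∷ minorShape m xs

length-minorShape : ∀ m l → m < length l → length (minorShape m l) ≡ pred (length l)
length-minorShape zero    (x ∷ l)     _         = refl
length-minorShape (suc m) (x ∷ y ∷ l) (s<s m<n) = cong suc (length-minorShape m (y ∷ l) m<n)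

row-minorShape-< : ∀ m j l → j < m → m < length l → row (minorShape m l) j ≡ suc (row l j)
row-minorShape-< (suc m) zero    (x ∷ l) _         _         = refl
row-minorShape-< (suc m) (suc j) (x ∷ l) (s<s j<m) (s<s m<n) = row-minorShape-< m j l j<m m<n

row-minorShape-≥ : ∀ m j l → m ≤ j → row (minorShape m l) j ≡ row l (suc j)
row-minorShape-≥ m       j       []      _         = refl
row-minorShape-≥ zero    j       (x ∷ l) _         = refl
row-minorShape-≥ (suc m) (suc j) (x ∷ l) (s≤s m≤j) = row-minorShape-≥ m j l m≤j

minorShape-inc-punchIn : ∀ m k l → minorShape m (inc (punchIn m k) l) ≡ inc k (minorShape m l)
minorShape-inc-punchIn zero    k       []      = refl
minorShape-inc-punchIn zero    k       (x ∷ l) = refl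
minorShape-inc-punchIn (suc m) zero    []      = refl
minorShape-inc-punchIn (suc m) zero    (x ∷ l) = refl
minorShape-inc-punchIn (suc m) (suc k) []      = refl
minorShape-inc-punchIn (suc m) (suc k) (x ∷ l) = cong (suc x ∷_) (minorShape-inc-punchIn m k l)

minorShape-inc-self : ∀ m l → minorShape m (inc m l) ≡ minorShape m l
minorShape-inc-self m       []      = refl
minorShape-inc-self zero    (x ∷ l) = refl
minorShape-inc-self (suc m) (x ∷ l) = cong (suc x ∷_) (minorShape-inc-self m l)

minorShape-adjacent : ∀ j l → row l (suc j) ≡ suc (row l j) → minorShape j l ≡ minorShape (suc j) l
minorShape-adjacent zero    (x ∷ y ∷ l) y≡ = cong (_∷ l) y≡
minorShape-adjacent (suc j) (x ∷ l)     eq = cong (suc x ∷_) (minorShape-adjacent j l eq)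

Decreasing-minorShape : ∀ m l → Decreasing l → m < length l → Decreasing (minorShape m l)
Decreasing-minorShape m l l↓ m<n i with suc i <? m | i <? m
... | yes i+1<m | _ = subst₂ _≤_ (sym (row-minorShape-< m (suc i) l i+1<m m<n))
                                 (sym (row-minorShape-< m i l (<-trans ≤-refl i+1<m) m<n)) (s≤s (l↓ i))
... | no i+1≮m | yes i<m = subst₂ _≤_ (sym (row-minorShape-≥ m (suc i) l (≮⇒≥ i+1≮m)))
                                      (sym (row-minorShape-< m i l i<m m<n))
                                      (≤-trans (l↓ (suc i)) (≤-trans (l↓ i) (n≤1+n _)))
... | no _ | no i≮m = subst₂ _≤_ (sym (row-minorShape-≥ m (suc i) l (≤-trans (≮⇒≥ i≮m) (n≤1+n i))))
                                 (sym (row-minorShape-≥ m i l (≮⇒≥ i≮m))) (l↓ (suc i))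

-- An ascent of l at rows j, j + 1 survives in minorShape m l unless m ∈ {j, j + 1}.
sytCount-minorShape-ascent : ∀ σ l m j → Decreasing σ → m < length l → m ≢ j → m ≢ suc j →
  row l j < row l (suc j) → sytCount σ (minorShape m l) ≡ 0
sytCount-minorShape-ascent σ l m j σ↓ m<n m≢j m≢j+1 ascent with m <? j
... | no m≮j = sytCount-unsorted σ (minorShape m l) j σ↓
    (subst₂ _<_ (sym (row-minorShape-< m j l j<m m<n)) (sym (row-minorShape-< m (suc j) l j+1<m m<n)) (s≤s ascent))
  where
  j<m : j < m
  j<m = ≤∧≢⇒< (≮⇒≥ m≮j) (m≢j ∘ sym)
  j+1<m : suc j < m
  j+1<m = ≤∧≢⇒< j<m (m≢j+1 ∘ sym)
sytCount-minorShape-ascent σ l m (suc i) σ↓ m<n m≢j m≢j+1 ascent | yes (s≤s m≤i) =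
  sytCount-unsorted σ (minorShape m l) i σ↓
    (subst₂ _<_ (sym (row-minorShape-≥ m i l m≤i)) (sym (row-minorShape-≥ m (suc i) l (≤-trans m≤i (n≤1+n i)))) ascent)

weighted : ℕ → List ℕ → List ℕ → ℕ
weighted N σ ν = (N C skewSize σ ν) * sytCount σ ν

weighted-pascal : ∀ N σ ν → Decreasing ν → length ν ≡ length σ →
  weighted N σ ν + ∑ℕ (length ν) (λ k → weighted N σ (inc k ν)) ≡ weighted (suc N) σ ν
weighted-pascal N σ ν ν↓ n≡ with sum ν <? sum σ
... | yes ν<σ = begin
    (N C skewSize σ ν) * f + ∑ℕ (length ν) (λ k → (N C skewSize σ (inc k ν)) * sytCount σ (inc k ν))
      ≡⟨ cong (λ t → (N C t) * f + ∑ℕ (length ν) (λ k → weighted N σ (inc k ν))) size≡ ⟩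
    (N C suc s) * f + ∑ℕ (length ν) (λ k → (N C skewSize σ (inc k ν)) * sytCount σ (inc k ν))
      ≡⟨ cong (_+_ ((N C suc s) * f)) (∑ℕ.∑-cong (length ν) (λ k k<n →
           cong (λ t → (N C t) * sytCount σ (inc k ν)) (skewSize-inc σ ν k s k<n size≡))) ⟩
    (N C suc s) * f + ∑ℕ (length ν) (λ k → (N C s) * sytCount σ (inc k ν))
      ≡⟨ cong (_+_ ((N C suc s) * f)) (∑ℕ.⊛-distribˡ-∑ (length ν) (N C s) _) ⟩
    (N C suc s) * f + (N C s) * ∑ℕ (length ν) (λ k → sytCount σ (inc k ν))
      ≡⟨ cong (λ x → (N C suc s) * f + (N C s) * x) (sym (sytCount-bottom σ ν ν↓ n≡ ν<σ)) ⟩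
    (N C suc s) * f + (N C s) * f
      ≡⟨ sym (*-distribʳ-+ f (N C suc s) (N C s)) ⟩
    ((N C suc s) + (N C s)) * f
      ≡⟨ cong (_* f) (trans (+-comm (N C suc s) (N C s)) (nCk+nC[k+1]≡[n+1]C[k+1] N s)) ⟩
    (suc N C suc s) * f
      ≡⟨ cong (λ t → (suc N C t) * f) (sym size≡) ⟩
    (suc N C skewSize σ ν) * f ∎
  where
  open ≡-Reasoning
  s = sum σ ∸ suc (sum ν)
  f = sytCount σ ν
  size≡ : skewSize σ ν ≡ suc s
  size≡ = m∸n≡suc[m∸1+n] ν<σ
... | no ν≮σ = trans (cong₂ (λ x y → (N C x) * sytCount σ ν + y) size≡0 rest≡0)
                     (trans (+-identityʳ _) (cong (λ x → (suc N C x) * sytCount σ ν) (sym size≡0)))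
  where
  size≡0 : skewSize σ ν ≡ 0
  size≡0 = m≤n⇒m∸n≡0 (≮⇒≥ ν≮σ)
  rest≡0 : ∑ℕ (length ν) (λ k → weighted N σ (inc k ν)) ≡ 0
  rest≡0 = ∑ℕ.∑-zero (length ν) (λ k k<n → trans
    (cong ((N C skewSize σ (inc k ν)) *_)
          (sytCount-sum> σ (inc k ν) (subst (sum σ <_) (sym (sum-inc k ν k<n)) (s≤s (≮⇒≥ ν≮σ)))))
    (*-zeroʳ (N C skewSize σ (inc k ν))))

aitkenTerm : ℕ → List ℕ → List ℕ → ℕ → ℤ
aitkenTerm N σ μ m = negOnePow m *ℤ + weighted N σ (minorShape m μ)

-- N! times the expansion along row 0 of the Aitken determinant of f^{(a ∷ σ) ∖ μ}, N = |(a ∷ σ) ∖ μ|: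
-- the entry 1 / (a − μₘ + m)! times the minor f^{σ ∖ ν} / |σ ∖ ν|!, ν = minorShape m μ, is
-- C(N, |σ ∖ ν|) f^{σ ∖ ν} / N!.
aitken : ℕ → List ℕ → List ℕ → ℤ
aitken a σ μ = ∑ℤ (suc (length σ)) (aitkenTerm (skewSize (a ∷ σ) μ) σ μ)

aitkenTerm-zero : ∀ N σ μ m → sytCount σ (minorShape m μ) ≡ 0 → aitkenTerm N σ μ m ≡ + 0
aitkenTerm-zero N σ μ m f≡0 rewrite f≡0 | *-zeroʳ (N C skewSize σ (minorShape m μ)) = ℤ.*-zeroʳ (negOnePow m)

-- Adding a box in row m of μ is invisible in minorShape m μ; adding it in any other row adds a box to
-- minorShape m μ. So the column sum is the left side of Pascal's rule (weighted-pascal).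
∑-weighted-minorShape-inc : ∀ N σ μ m → Decreasing μ → length μ ≡ suc (length σ) → m ≤ length σ →
  ∑ℤ (suc (length σ)) (λ k → + weighted N σ (minorShape m (inc k μ))) ≡ + weighted (suc N) σ (minorShape m μ)
∑-weighted-minorShape-inc N σ μ m μ↓ n≡ m≤L = begin
  ∑ℤ (suc L) (λ k → + weighted N σ (minorShape m (inc k μ)))
    ≡⟨ ∑ℤ.∑-punchIn L m (λ k → + weighted N σ (minorShape m (inc k μ))) m≤L ⟩
  + weighted N σ (minorShape m (inc m μ)) +ℤ ∑ℤ L (λ k → + weighted N σ (minorShape m (inc (punchIn m k) μ)))
    ≡⟨ cong₂ _+ℤ_ (cong (+_ ∘ weighted N σ) (minorShape-inc-self m μ))
                  (∑ℤ.∑-cong L (λ k _ → cong (+_ ∘ weighted N σ) (minorShape-inc-punchIn m k μ))) ⟩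
  + weighted N σ ν +ℤ ∑ℤ L (λ k → + weighted N σ (inc k ν))
    ≡⟨ cong (+ weighted N σ ν +ℤ_) (sym (+-∑ L (λ k → weighted N σ (inc k ν)))) ⟩
  + weighted N σ ν +ℤ + ∑ℕ L (λ k → weighted N σ (inc k ν))
    ≡⟨ sym (ℤ.pos-+ (weighted N σ ν) _) ⟩
  + (weighted N σ ν + ∑ℕ L (λ k → weighted N σ (inc k ν)))
    ≡⟨ cong (λ n → + (weighted N σ ν + ∑ℕ n (λ k → weighted N σ (inc k ν)))) (sym ν-length) ⟩
  + (weighted N σ ν + ∑ℕ (length ν) (λ k → weighted N σ (inc k ν)))
    ≡⟨ cong +_ (weighted-pascal N σ ν (Decreasing-minorShape m μ μ↓ m<n) ν-length) ⟩
  + weighted (suc N) σ ν ∎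
  where
  open ≡-Reasoning
  L = length σ
  ν = minorShape m μ
  m<n : m < length μ
  m<n = subst (m <_) (sym n≡) (s≤s m≤L)
  ν-length : length ν ≡ L
  ν-length = trans (length-minorShape m μ m<n) (cong pred n≡)

aitken-bottom : ∀ a σ μ N → Decreasing μ → length μ ≡ suc (length σ) → skewSize (a ∷ σ) μ ≡ suc N →
  ∑ℤ (suc (length σ)) (λ k → aitken a σ (inc k μ)) ≡ aitken a σ μ
aitken-bottom a σ μ N μ↓ n≡ size≡ = begin
  ∑ℤ (suc L) (λ k → ∑ℤ (suc L) (aitkenTerm (skewSize (a ∷ σ) (inc k μ)) σ (inc k μ)))
    ≡⟨ ∑ℤ.∑-cong (suc L) (λ k k<n → cong (λ t → ∑ℤ (suc L) (aitkenTerm t σ (inc k μ)))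
                                          (skewSize-inc (a ∷ σ) μ k N (subst (k <_) (sym n≡) k<n) size≡)) ⟩
  ∑ℤ (suc L) (λ k → ∑ℤ (suc L) (λ m → negOnePow m *ℤ + weighted N σ (minorShape m (inc k μ))))
    ≡⟨ ∑ℤ.∑-swap (suc L) (suc L) (λ k m → negOnePow m *ℤ + weighted N σ (minorShape m (inc k μ))) ⟩
  ∑ℤ (suc L) (λ m → ∑ℤ (suc L) (λ k → negOnePow m *ℤ + weighted N σ (minorShape m (inc k μ))))
    ≡⟨ ∑ℤ.∑-cong (suc L) (λ m _ → ∑ℤ.⊛-distribˡ-∑ (suc L) (negOnePow m) (λ k → + weighted N σ (minorShape m (inc k μ)))) ⟩
  ∑ℤ (suc L) (λ m → negOnePow m *ℤ ∑ℤ (suc L) (λ k → + weighted N σ (minorShape m (inc k μ))))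
    ≡⟨ ∑ℤ.∑-cong (suc L) (λ m m<n → cong (negOnePow m *ℤ_) (∑-weighted-minorShape-inc N σ μ m μ↓ n≡ (s≤s⁻¹ m<n))) ⟩
  ∑ℤ (suc L) (λ m → negOnePow m *ℤ + weighted (suc N) σ (minorShape m μ))
    ≡⟨ ∑ℤ.∑-cong (suc L) (λ m _ → cong (λ t → aitkenTerm t σ μ m) (sym size≡)) ⟩
  aitken a σ μ ∎
  where
  open ≡-Reasoning
  L = length σ

alternating-pair : ∀ j x → negOnePow j *ℤ x +ℤ negOnePow (suc j) *ℤ x ≡ + 0
alternating-pair j x = trans (cong (negOnePow j *ℤ x +ℤ_) (sym (ℤ.neg-distribˡ-* (negOnePow j) x)))
                             (ℤ.+-inverseʳ (negOnePow j *ℤ x))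

-- Only the columns j and j + 1 survive, and they are equal.
aitken-inc-repeatedRow : ∀ a σ μ j → Decreasing σ → length μ ≡ suc (length σ) → suc j < length μ →
  row μ (suc j) ≡ row μ j → aitken a σ (inc (suc j) μ) ≡ + 0
aitken-inc-repeatedRow a σ μ j σ↓ n≡ j+1<n repeated = begin
  ∑ℤ (suc (length σ)) (aitkenTerm N σ ν)
    ≡⟨ ∑ℤ.∑-pair (length σ) j (suc j) ≤-refl (s≤s⁻¹ (subst (suc j <_) n≡ j+1<n)) others ⟩
  aitkenTerm N σ ν j +ℤ aitkenTerm N σ ν (suc j)
    ≡⟨ cong (λ x → aitkenTerm N σ ν j +ℤ negOnePow (suc j) *ℤ + weighted N σ x) (sym (minorShape-adjacent j ν adjacent)) ⟩
  aitkenTerm N σ ν j +ℤ negOnePow (suc j) *ℤ + weighted N σ (minorShape j ν)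
    ≡⟨ alternating-pair j _ ⟩
  + 0 ∎
  where
  open ≡-Reasoning
  ν = inc (suc j) μ
  N = skewSize (a ∷ σ) ν
  νⱼ≡ : row ν j ≡ row μ j
  νⱼ≡ = row-inc-≢ (suc j) j μ (λ ())
  νⱼ₊₁≡ : row ν (suc j) ≡ suc (row μ (suc j))
  νⱼ₊₁≡ = row-inc-≡ (suc j) μ j+1<n
  adjacent : row ν (suc j) ≡ suc (row ν j)
  adjacent = trans νⱼ₊₁≡ (cong suc (trans repeated (sym νⱼ≡)))
  others : ∀ m → m < suc (length σ) → m ≢ j → m ≢ suc j → aitkenTerm N σ ν m ≡ + 0
  others m m<n m≢j m≢j+1 = aitkenTerm-zero N σ ν m (sytCount-minorShape-ascent σ ν m j σ↓
    (subst (m <_) (sym (trans (length-inc (suc j) μ) n≡)) m<n) m≢j m≢j+1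
    (subst (row ν j <_) (sym adjacent) ≤-refl))

aitken-inc-fullFirstRow : ∀ a σ μ N → Decreasing (a ∷ σ) → length μ ≡ suc (length σ) → row μ 0 ≡ a →
  skewSize (a ∷ σ) μ ≡ suc N → aitken a σ (inc 0 μ) ≡ + 0
aitken-inc-fullFirstRow a σ (.a ∷ μ′) N lam↓ _ refl size≡ = ∑ℤ.∑-zero (suc (length σ)) term≡0
  where
  ν = suc a ∷ μ′
  N≡ : skewSize (a ∷ σ) ν ≡ N
  N≡ = skewSize-inc (a ∷ σ) (a ∷ μ′) 0 N z<s size≡
  σ∖μ′ : skewSize σ μ′ ≡ suc N
  σ∖μ′ = trans (sym ([m+n]∸[m+o]≡n∸o a (sum σ) (sum μ′))) size≡
  term≡0 : ∀ m → m < suc (length σ) → aitkenTerm (skewSize (a ∷ σ) ν) σ ν m ≡ + 0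
  term≡0 zero    _ = cong (λ x → + 1 *ℤ + (x * sytCount σ μ′))
                          (trans (cong₂ _C_ N≡ σ∖μ′) (k>n⇒nCk≡0 (n<1+n N)))
  term≡0 (suc m) _ = aitkenTerm-zero (skewSize (a ∷ σ) ν) σ ν (suc m)
    (sytCount-⊈ σ (minorShape (suc m) ν) 0 (s≤s (≤-trans (lam↓ 0) (n≤1+n a))))

aitken-inc-fullRow : ∀ a σ μ j → Decreasing μ → length μ ≡ suc (length σ) → suc j < length μ →
  row μ (suc j) ≡ row σ j → aitken a σ (inc (suc j) μ) ≡ + 0
aitken-inc-fullRow a σ μ j μ↓ n≡ j+1<n full = ∑ℤ.∑-zero (suc (length σ)) λ m m<n →
  aitkenTerm-zero (skewSize (a ∷ σ) ν) σ ν m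
    (sytCount-⊈ σ (minorShape m ν) j
      (overfull m (subst (m <_) (sym (trans (length-inc (suc j) μ) n≡)) m<n)))
  where
  ν = inc (suc j) μ
  overfull : ∀ m → m < length ν → row σ j < row (minorShape m ν) j
  overfull m m<n with j <? m
  ... | yes j<m = subst (row σ j <_) (sym (trans (row-minorShape-< m j ν j<m m<n) (cong suc (row-inc-≢ (suc j) j μ (λ ())))))
                        (s≤s (subst (_≤ row μ j) full (μ↓ j)))
  ... | no  j≮m = subst (row σ j <_) (sym (trans (row-minorShape-≥ m j ν (≮⇒≥ j≮m)) (row-inc-≡ (suc j) μ j+1<n)))
                        (s≤s (≤-reflexive (sym full)))

aitken-full : ∀ a σ → Decreasing (a ∷ σ) → aitken a σ (a ∷ σ) ≡ + 1
aitken-full a σ lam↓ = trans (∑ℤ.∑-single (suc (length σ)) 0 z<s others) first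
  where
  N = skewSize (a ∷ σ) (a ∷ σ)
  first : aitkenTerm N σ (a ∷ σ) 0 ≡ + 1
  first = cong (λ x → + 1 *ℤ + x)
    (cong₂ _*_ (cong₂ _C_ (n∸n≡0 (a + sum σ)) (n∸n≡0 (sum σ))) (sytCount-refl σ))
  others : ∀ m → m < suc (length σ) → m ≢ 0 → aitkenTerm N σ (a ∷ σ) m ≡ + 0
  others zero    _ 0≢0 = ⊥-elim (0≢0 refl)
  others (suc m) _ _   = aitkenTerm-zero N σ (a ∷ σ) (suc m)
    (sytCount-⊈ σ (minorShape (suc m) (a ∷ σ)) 0 (s≤s (lam↓ 0)))

-- Induction on |lam ∖ mu|: both sides satisfy the recursion that adds a box to mu in every
-- possible row (sytCount-bottom, aitken-bottom), and both vanish when the added box is illegal.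
sytCount-aitken : ∀ N a σ μ → Decreasing (a ∷ σ) → Decreasing μ → length μ ≡ suc (length σ) →
  μ ⊆ (a ∷ σ) → skewSize (a ∷ σ) μ ≡ N → + sytCount (a ∷ σ) μ ≡ aitken a σ μ
sytCount-aitken zero a σ μ lam↓ μ↓ n≡ μ⊆ size≡ with ⊆-antisym-sum μ (a ∷ σ) n≡ μ⊆ (m∸n≡0⇒m≤n size≡)
... | refl = trans (cong +_ (sytCount-refl (a ∷ σ))) (sym (aitken-full a σ lam↓))
sytCount-aitken (suc N) a σ μ lam↓ μ↓ n≡ μ⊆ size≡ = begin
  + sytCount lam μ
    ≡⟨ cong +_ (sytCount-bottom lam μ μ↓ n≡ (m∸n≢0⇒n<m (λ size≡0 → 0≢1+n (trans (sym size≡0) size≡)))) ⟩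
  + ∑ℕ (length μ) (λ k → sytCount lam (inc k μ))
    ≡⟨ +-∑ (length μ) (λ k → sytCount lam (inc k μ)) ⟩
  ∑ℤ (length μ) (λ k → + sytCount lam (inc k μ))
    ≡⟨ ∑ℤ.∑-cong (length μ) addBox ⟩
  ∑ℤ (length μ) (λ k → aitken a σ (inc k μ))
    ≡⟨ cong (λ n → ∑ℤ n (λ k → aitken a σ (inc k μ))) n≡ ⟩
  ∑ℤ (suc (length σ)) (λ k → aitken a σ (inc k μ))
    ≡⟨ aitken-bottom a σ μ N μ↓ n≡ size≡ ⟩
  aitken a σ μ ∎
  where
  open ≡-Reasoning
  lam = a ∷ σ
  byInduction : ∀ k → k < length μ → row μ k < row lam k → Decreasing (inc k μ) →
    + sytCount lam (inc k μ) ≡ aitken a σ (inc k μ)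
  byInduction k k<n room inc↓ = sytCount-aitken N a σ (inc k μ) lam↓ inc↓ (trans (length-inc k μ) n≡)
    (inc-⊆ μ lam k μ⊆ room) (skewSize-inc lam μ k N k<n size≡)
  fullRow : ∀ k → k < length μ → row μ k ≡ row lam k → aitken a σ (inc k μ) ≡ + 0
  fullRow zero    _   full = aitken-inc-fullFirstRow a σ μ N lam↓ n≡ full size≡
  fullRow (suc j) k<n full = aitken-inc-fullRow a σ μ j μ↓ n≡ k<n full
  addBox : ∀ k → k < length μ → + sytCount lam (inc k μ) ≡ aitken a σ (inc k μ)
  addBox k k<n with row μ k <? row lam k
  addBox zero k<n | yes room = byInduction zero k<n room (Decreasing-inc μ zero μ↓ (λ _ ()))
  addBox (suc j) k<n | yes room with row μ (suc j) <? row μ j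
  ... | yes corner = byInduction (suc j) k<n room (Decreasing-inc μ (suc j) μ↓ (λ { _ refl → corner }))
  ... | no  flat   = trans (cong +_ (sytCount-unsorted lam (inc (suc j) μ) j lam↓
                       (subst₂ _<_ (sym (row-inc-≢ (suc j) j μ (λ ()))) (sym (row-inc-≡ (suc j) μ k<n)) (s≤s (≮⇒≥ flat)))))
                     (sym (aitken-inc-repeatedRow a σ μ j (lam↓ ∘ suc) n≡ k<n (≤-antisym (μ↓ j) (≮⇒≥ flat))))
  addBox k k<n | no full = trans (cong +_ (sytCount-⊈ lam (inc k μ) k
                             (subst (row lam k <_) (sym (row-inc-≡ k μ k<n)) (s≤s (≮⇒≥ full)))))
                           (sym (fullRow k k<n (≤-antisym (μ⊆ k) (≮⇒≥ full))))

-- Linear combinations of binomial coefficients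

-- A list of pairs (c , d) stands for the function x ↦ Σ c · C(x, d).
BinomialSum : Set
BinomialSum = List (ℤ × ℕ)

eval : BinomialSum → ℕ → ℤ
eval []             x = + 0
eval ((c , d) ∷ ts) x = c *ℤ + (x C d) +ℤ eval ts x

coeff : BinomialSum → ℕ → ℤ
coeff []              d = + 0
coeff ((c , d′) ∷ ts) d = (if d′ ≡ᵇ d then c else + 0) +ℤ coeff ts d

degree : BinomialSum → ℕ
degree []             = 0
degree ((_ , d) ∷ ts) = d ⊔ degree ts

tabulate : ℕ → (ℕ → ℤ) → (ℕ → ℕ) → BinomialSum
tabulate zero    c deg = []
tabulate (suc n) c deg = (c 0 , deg 0) ∷ tabulate n (c ∘ suc) (deg ∘ suc)

scale : ℤ → BinomialSum → BinomialSum
scale a = map (λ (c , d) → (a *ℤ c , d))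

eval-tabulate : ∀ n c deg x → eval (tabulate n c deg) x ≡ ∑ℤ n (λ i → c i *ℤ + (x C deg i))
eval-tabulate zero    c deg x = refl
eval-tabulate (suc n) c deg x = cong (c 0 *ℤ + (x C deg 0) +ℤ_) (eval-tabulate n (c ∘ suc) (deg ∘ suc) x)

coeff-tabulate : ∀ n c deg d → coeff (tabulate n c deg) d ≡ ∑ℤ n (λ i → if deg i ≡ᵇ d then c i else + 0)
coeff-tabulate zero    c deg d = refl
coeff-tabulate (suc n) c deg d = cong ((if deg 0 ≡ᵇ d then c 0 else + 0) +ℤ_) (coeff-tabulate n (c ∘ suc) (deg ∘ suc) d)

eval-++ : ∀ ts us x → eval (ts ++ us) x ≡ eval ts x +ℤ eval us x
eval-++ []             us x = sym (ℤ.+-identityˡ _)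
eval-++ ((c , d) ∷ ts) us x = trans (cong (c *ℤ + (x C d) +ℤ_) (eval-++ ts us x)) (sym (ℤ.+-assoc (c *ℤ + (x C d)) (eval ts x) (eval us x)))

coeff-++ : ∀ ts us d → coeff (ts ++ us) d ≡ coeff ts d +ℤ coeff us d
coeff-++ []              us d = sym (ℤ.+-identityˡ _)
coeff-++ ((c , d′) ∷ ts) us d = trans (cong (δ +ℤ_) (coeff-++ ts us d)) (sym (ℤ.+-assoc δ (coeff ts d) (coeff us d)))
  where
  δ : ℤ
  δ = if d′ ≡ᵇ d then c else + 0

eval-scale : ∀ a ts x → eval (scale a ts) x ≡ a *ℤ eval ts x
eval-scale a []             x = sym (ℤ.*-zeroʳ a)
eval-scale a ((c , d) ∷ ts) x = trans (cong₂ _+ℤ_ (ℤ.*-assoc a c _) (eval-scale a ts x)) (sym (ℤ.*-distribˡ-+ a _ _))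

coeff-scale : ∀ a ts d → coeff (scale a ts) d ≡ a *ℤ coeff ts d
coeff-scale a []              d = sym (ℤ.*-zeroʳ a)
coeff-scale a ((c , d′) ∷ ts) d = trans (cong₂ _+ℤ_ (if-* (d′ ≡ᵇ d)) (coeff-scale a ts d)) (sym (ℤ.*-distribˡ-+ a _ _))
  where
  if-* : ∀ b → (if b then a *ℤ c else + 0) ≡ a *ℤ (if b then c else + 0)
  if-* true  = refl
  if-* false = sym (ℤ.*-zeroʳ a)

eval-concatMap : ∀ {A : Set} (f : A → BinomialSum) xs x → eval (concatMap f xs) x ≡ sumℤ (map (λ y → eval (f y) x) xs)
eval-concatMap f []       x = refl
eval-concatMap f (y ∷ xs) x = trans (eval-++ (f y) (concatMap f xs) x) (cong (eval (f y) x +ℤ_) (eval-concatMap f xs x))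

coeff-concatMap : ∀ {A : Set} (f : A → BinomialSum) xs d → coeff (concatMap f xs) d ≡ sumℤ (map (λ y → coeff (f y) d) xs)
coeff-concatMap f []       d = refl
coeff-concatMap f (y ∷ xs) d = trans (coeff-++ (f y) (concatMap f xs) d) (cong (coeff (f y) d +ℤ_) (coeff-concatMap f xs d))

coeff->degree : ∀ ts d → degree ts < d → coeff ts d ≡ + 0
coeff->degree []              d _ = refl
coeff->degree ((c , d′) ∷ ts) d deg<d = cong₂ _+ℤ_
  (cong (λ b → if b then c else + 0) (≡ᵇ≡false (λ d′≡d → <-irrefl d′≡d (≤-<-trans (m≤m⊔n d′ (degree ts)) deg<d))))
  (coeff->degree ts d (≤-<-trans (m≤n⊔m d′ (degree ts)) deg<d))

eval-∑ : ∀ ts D x → degree ts < D → eval ts x ≡ ∑ℤ D (λ d → coeff ts d *ℤ + (x C d))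
eval-∑ [] D x _ = sym (∑ℤ.∑-zero D (λ _ _ → refl))
eval-∑ ((c , d′) ∷ ts) D x deg<D = begin
  c *ℤ + (x C d′) +ℤ eval ts x
    ≡⟨ cong₂ _+ℤ_ (sym head) (eval-∑ ts D x (≤-<-trans (m≤n⊔m d′ (degree ts)) deg<D)) ⟩
  ∑ℤ D (λ d → δ d *ℤ + (x C d)) +ℤ ∑ℤ D (λ d → coeff ts d *ℤ + (x C d))
    ≡⟨ sym (∑ℤ.∑-distrib-⊕ D _ _) ⟩
  ∑ℤ D (λ d → δ d *ℤ + (x C d) +ℤ coeff ts d *ℤ + (x C d))
    ≡⟨ ∑ℤ.∑-cong D (λ d _ → sym (ℤ.*-distribʳ-+ (+ (x C d)) (δ d) (coeff ts d))) ⟩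
  ∑ℤ D (λ d → (δ d +ℤ coeff ts d) *ℤ + (x C d)) ∎
  where
  open ≡-Reasoning
  δ : ℕ → ℤ
  δ d = if d′ ≡ᵇ d then c else + 0
  head : ∑ℤ D (λ d → δ d *ℤ + (x C d)) ≡ c *ℤ + (x C d′)
  head = trans (∑ℤ.∑-single D d′ (≤-<-trans (m≤m⊔n d′ (degree ts)) deg<D)
                  (λ d _ d≢d′ → cong (λ b → (if b then c else + 0) *ℤ + (x C d)) (≡ᵇ≡false (d≢d′ ∘ sym))))
               (cong (λ b → (if b then c else + 0) *ℤ + (x C d′)) (≡ᵇ≡true {d′} refl))

-- Finite differences: if Σ_{d ≤ D} c_d C(x, d) vanishes for large x, so does its difference
-- Σ_{d < D} c_{d+1} C(x, d), and induction on D applies.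
binomial-independent : ∀ D (c : ℕ → ℤ) x₀ → (∀ x → x₀ ≤ x → ∑ℤ D (λ d → c d *ℤ + (x C d)) ≡ + 0) →
  ∀ d → d < D → c d ≡ + 0
binomial-independent (suc D) c x₀ vanish = c≡0
  where
  higher lowered : ℕ → ℤ
  higher  x = ∑ℤ D (λ d → c (suc d) *ℤ + (x C suc d))
  lowered x = ∑ℤ D (λ d → c (suc d) *ℤ + (x C d))
  pascal : ∀ x → higher (suc x) ≡ lowered x +ℤ higher x
  pascal x = trans (∑ℤ.∑-cong D (λ d _ → begin
      c (suc d) *ℤ + (suc x C suc d)                       ≡⟨ cong (λ n → c (suc d) *ℤ + n) (sym (nCk+nC[k+1]≡[n+1]C[k+1] x d)) ⟩
      c (suc d) *ℤ (+ (x C d) +ℤ + (x C suc d))             ≡⟨ ℤ.*-distribˡ-+ (c (suc d)) _ _ ⟩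
      c (suc d) *ℤ + (x C d) +ℤ c (suc d) *ℤ + (x C suc d)  ∎))
    (∑ℤ.∑-distrib-⊕ D _ _)
    where open ≡-Reasoning
  vanish′ : ∀ x → x₀ ≤ x → c 0 +ℤ higher x ≡ + 0
  vanish′ x x₀≤x = trans (cong (_+ℤ higher x) (sym (ℤ.*-identityʳ (c 0)))) (vanish x x₀≤x)
  lowered≡0 : ∀ x → x₀ ≤ x → lowered x ≡ + 0
  lowered≡0 x x₀≤x = identityˡ-unique (lowered x) (higher x) (sym (∙-cancelˡ (c 0) (higher x) _
    (trans (vanish′ x x₀≤x) (sym (trans (cong (c 0 +ℤ_) (sym (pascal x))) (vanish′ (suc x) (m≤n⇒m≤1+n x₀≤x)))))))
  tail≡0 : ∀ d → d < D → c (suc d) ≡ + 0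
  tail≡0 = binomial-independent D (c ∘ suc) x₀ lowered≡0
  c≡0 : ∀ d → d < suc D → c d ≡ + 0
  c≡0 (suc d) (s≤s d<D) = tail≡0 d d<D
  c≡0 zero    _         = begin
    c 0                   ≡⟨ sym (ℤ.+-identityʳ (c 0)) ⟩
    c 0 +ℤ + 0            ≡⟨ cong (c 0 +ℤ_) (sym (∑ℤ.∑-zero D (λ d d<D → cong (_*ℤ + (x₀ C suc d)) (tail≡0 d d<D)))) ⟩
    c 0 +ℤ higher x₀      ≡⟨ vanish′ x₀ ≤-refl ⟩
    + 0                   ∎
    where open ≡-Reasoning

coeff-vanishing : ∀ ts x₀ → (∀ x → x₀ ≤ x → eval ts x ≡ + 0) → ∀ d → coeff ts d ≡ + 0
coeff-vanishing ts x₀ vanish d with d <? suc (degree ts)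
... | yes d≤deg = binomial-independent (suc (degree ts)) (coeff ts) x₀
                    (λ x x₀≤x → trans (sym (eval-∑ ts (suc (degree ts)) x ≤-refl)) (vanish x x₀≤x)) d d≤deg
... | no  d≰deg = coeff->degree ts d (≮⇒≥ d≰deg)

coeff-unique : ∀ ts us x₀ → (∀ x → x₀ ≤ x → eval ts x ≡ eval us x) → ∀ d → coeff ts d ≡ coeff us d
coeff-unique ts us x₀ agree d = x∙y⁻¹≈ε⇒x≈y (coeff ts d) (coeff us d) (begin
  coeff ts d +ℤ - coeff us d              ≡⟨ cong (coeff ts d +ℤ_) (sym (ℤ.-1*i≡-i (coeff us d))) ⟩
  coeff ts d +ℤ - + 1 *ℤ coeff us d       ≡⟨ cong (coeff ts d +ℤ_) (sym (coeff-scale (- + 1) us d)) ⟩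
  coeff ts d +ℤ coeff (scale (- + 1) us) d ≡⟨ sym (coeff-++ ts (scale (- + 1) us) d) ⟩
  coeff (ts ++ scale (- + 1) us) d        ≡⟨ coeff-vanishing (ts ++ scale (- + 1) us) x₀ difference≡0 d ⟩
  + 0                                     ∎)
  where
  open ≡-Reasoning
  difference≡0 : ∀ x → x₀ ≤ x → eval (ts ++ scale (- + 1) us) x ≡ + 0
  difference≡0 x x₀≤x = begin
    eval (ts ++ scale (- + 1) us) x         ≡⟨ eval-++ ts (scale (- + 1) us) x ⟩
    eval ts x +ℤ eval (scale (- + 1) us) x  ≡⟨ cong₂ _+ℤ_ (agree x x₀≤x) (eval-scale (- + 1) us x) ⟩
    eval us x +ℤ - + 1 *ℤ eval us x         ≡⟨ cong (eval us x +ℤ_) (ℤ.-1*i≡-i (eval us x)) ⟩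
    eval us x +ℤ - eval us x                ≡⟨ ℤ.+-inverseʳ (eval us x) ⟩
    + 0                                     ∎

row-++-zeros : ∀ l p j → row (l ++ replicate p 0) j ≡ row l j
row-++-zeros []      zero    j       = refl
row-++-zeros []      (suc p) zero    = refl
row-++-zeros []      (suc p) (suc j) = row-++-zeros [] p j
row-++-zeros (x ∷ l) p       zero    = refl
row-++-zeros (x ∷ l) p       (suc j) = row-++-zeros l p j

row-injective : ∀ (l l′ : List ℕ) → length l ≡ length l′ → (∀ i → row l i ≡ row l′ i) → l ≡ l′
row-injective []      []       _  _    = refl
row-injective (x ∷ l) (y ∷ l′) n≡ rows = cong₂ _∷_ (rows 0) (row-injective l l′ (suc-injective n≡) (rows ∘ suc))

dec-++ : ∀ i l z → i < length l → dec i (l ++ z) ≡ dec i l ++ z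
dec-++ zero    (x ∷ l) z _         = refl
dec-++ (suc i) (x ∷ l) z (s<s i<n) = cong (x ∷_) (dec-++ i l z i<n)

chains-++-zeros : ∀ m l n p → length l ≡ length n → chains m (l ++ replicate p 0) (n ++ replicate p 0) ≡ chains m l n
chains-++-zeros zero l n p n≡ with ≡-dec _≟_ l n
... | yes refl rewrite ==≡true {l ++ replicate p 0} refl = refl
... | no  l≢n  rewrite ==≡false {l ++ replicate p 0} {n ++ replicate p 0}
        (λ eq → l≢n (row-injective l n n≡ (λ j → trans (sym (row-++-zeros l p j))
                                                   (trans (cong (λ t → row t j) eq) (row-++-zeros n p j))))) = refl
chains-++-zeros (suc m) l n p n≡ = begin
  chains (suc m) (l ++ z) (n ++ z)
    ≡⟨ chains-top m (l ++ z) (n ++ z) ⟩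
  ∑ℕ (length (l ++ z)) step
    ≡⟨ cong (λ t → ∑ℕ t step) (trans (length-++ l) (cong (_+_ (length l)) (length-replicate p))) ⟩
  ∑ℕ (length l + p) step
    ≡⟨ ∑ℕ.∑-split (length l) p step ⟩
  ∑ℕ (length l) step + ∑ℕ p (λ i → step (length l + i))
    ≡⟨ cong₂ _+_ (∑ℕ.∑-cong (length l) inside) (∑ℕ.∑-zero p (λ i _ → outside i)) ⟩
  ∑ℕ (length l) (λ i → if removable l n i then chains m (dec i l) n else 0) + 0
    ≡⟨ +-identityʳ _ ⟩
  ∑ℕ (length l) (λ i → if removable l n i then chains m (dec i l) n else 0)
    ≡⟨ sym (chains-top m l n) ⟩
  chains (suc m) l n ∎
  where
  open ≡-Reasoning
  z = replicate p 0
  step : ℕ → ℕ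
  step i = if removable (l ++ z) (n ++ z) i then chains m (dec i (l ++ z)) (n ++ z) else 0
  removable-++ : ∀ i → removable (l ++ z) (n ++ z) i ≡ removable l n i
  removable-++ i rewrite row-++-zeros l p i | row-++-zeros l p (suc i) | row-++-zeros n p i = refl
  inside : ∀ i → i < length l → step i ≡ (if removable l n i then chains m (dec i l) n else 0)
  inside i i<n rewrite removable-++ i | dec-++ i l z i<n
    | chains-++-zeros m (dec i l) n p (trans (length-dec i l) n≡) = refl
  outside : ∀ i → step (length l + i) ≡ 0
  outside i rewrite row-++-zeros l p (length l + i) | row-≥length l (length l + i) (m≤m+n (length l) i) = refl

pad-++ : ∀ l p → pad (length l + p) l ≡ l ++ replicate p 0
pad-++ l p = trans (map-applyUpTo (λ i → i) (row l) (length l + p)) (applyUpTo-row l p)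
  where
  applyUpTo-row : ∀ l p → applyUpTo (row l) (length l + p) ≡ l ++ replicate p 0
  applyUpTo-row []      zero    = refl
  applyUpTo-row []      (suc p) = cong (0 ∷_) (applyUpTo-row [] p)
  applyUpTo-row (x ∷ l) p       = cong (x ∷_) (applyUpTo-row l p)

replicate-+ : ∀ m n (x : ℕ) → replicate (m + n) x ≡ replicate m x ++ replicate n x
replicate-+ zero    n x = refl
replicate-+ (suc m) n x = cong (x ∷_) (replicate-+ m n x)

sum-++-zeros : ∀ l p → sum (l ++ replicate p 0) ≡ sum l
sum-++-zeros l p = trans (sum-++ l (replicate p 0)) (trans (cong (_+_ (sum l)) (sum-zeros p)) (+-identityʳ (sum l)))
  where
  sum-zeros : ∀ p → sum (replicate p 0) ≡ 0
  sum-zeros zero    = refl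
  sum-zeros (suc p) = sum-zeros p

sum-ones : ∀ m → sum (replicate m 1) ≡ m
sum-ones zero    = refl
sum-ones (suc m) = cong suc (sum-ones m)

row-zeros : ∀ n i → row (replicate n 0) i ≡ 0
row-zeros zero    i       = refl
row-zeros (suc n) zero    = refl
row-zeros (suc n) (suc i) = row-zeros n i

-- fskew pads both shapes to length (length lam + length nu); the extra zero rows are inert.
fskew-sytCount : ∀ lam nu → length nu ≤ length lam →
  fskew lam nu ≡ sytCount lam (nu ++ replicate (length lam ∸ length nu) 0)
fskew-sytCount lam nu M≤L = begin
  chains (sum lam ∸ sum nu) (pad (L + M) lam) (pad (L + M) nu)
    ≡⟨ cong₂ (chains (sum lam ∸ sum nu)) (pad-++ lam M) padded-nu ⟩
  chains (sum lam ∸ sum nu) (lam ++ replicate M 0) (nu′ ++ replicate M 0)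
    ≡⟨ chains-++-zeros (sum lam ∸ sum nu) lam nu′ M (sym length-nu′) ⟩
  chains (sum lam ∸ sum nu) lam nu′
    ≡⟨ cong (λ s → chains (sum lam ∸ s) lam nu′) (sym (sum-++-zeros nu (L ∸ M))) ⟩
  sytCount lam nu′ ∎
  where
  open ≡-Reasoning
  L = length lam
  M = length nu
  nu′ = nu ++ replicate (L ∸ M) 0
  length-nu′ : length nu′ ≡ L
  length-nu′ = trans (length-++ nu) (trans (cong (_+_ M) (length-replicate (L ∸ M))) (m+[n∸m]≡n M≤L))
  padded-nu : pad (L + M) nu ≡ nu′ ++ replicate M 0
  padded-nu = begin
    pad (L + M) nu                              ≡⟨ cong (λ t → pad t nu) (trans (cong (_+ M) (sym (m+[n∸m]≡n M≤L))) (+-assoc M (L ∸ M) M)) ⟩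
    pad (M + (L ∸ M + M)) nu                    ≡⟨ pad-++ nu (L ∸ M + M) ⟩
    nu ++ replicate (L ∸ M + M) 0               ≡⟨ cong (nu ++_) (replicate-+ (L ∸ M) M 0) ⟩
    nu ++ (replicate (L ∸ M) 0 ++ replicate M 0) ≡⟨ sym (++-assoc nu _ _) ⟩
    nu′ ++ replicate M 0                        ∎

sytCount-ones : ∀ ρ m → m ≤ length ρ → sytCount ρ (replicate m 1 ++ replicate (length ρ ∸ m) 0) ≡ fskew ρ (replicate m 1)
sytCount-ones ρ m m≤L = begin
  sytCount ρ (replicate m 1 ++ replicate (L ∸ m) 0)
    ≡⟨ cong (λ k → sytCount ρ (replicate m 1 ++ replicate (L ∸ k) 0)) (sym (length-replicate m)) ⟩
  sytCount ρ (replicate m 1 ++ replicate (L ∸ length (replicate m 1)) 0)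
    ≡⟨ sym (fskew-sytCount ρ (replicate m 1) (subst (_≤ L) (sym (length-replicate m)) m≤L)) ⟩
  fskew ρ (replicate m 1) ∎
  where
  open ≡-Reasoning
  L = length ρ

fskew-ones-> : ∀ lam h → length lam < h → fskew lam (replicate h 1) ≡ 0
fskew-ones-> lam h L<h = chains-⊈ (sum lam ∸ sum (replicate h 1)) (pad N lam) (pad N (replicate h 1)) L
  (subst₂ _<_ (sym row-lam) (sym row-ones) z<s)
  where
  L = length lam
  N = L + length (replicate h 1)
  row-lam : row (pad N lam) L ≡ 0
  row-lam = trans (cong (λ l → row l L) (pad-++ lam (length (replicate h 1))))
                  (trans (row-++-zeros lam _ L) (row-≥length lam L ≤-refl))
  ones-row : ∀ h i → i < h → row (replicate h 1) i ≡ 1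
  ones-row (suc h) zero    _         = refl
  ones-row (suc h) (suc i) (s<s i<h) = ones-row h i i<h
  row-ones : row (pad N (replicate h 1)) L ≡ 1
  row-ones = begin
    row (pad N (replicate h 1)) L                 ≡⟨ cong (λ t → row (pad t (replicate h 1)) L) N≡ ⟩
    row (pad (length (replicate h 1) + L) (replicate h 1)) L ≡⟨ cong (λ l → row l L) (pad-++ (replicate h 1) L) ⟩
    row (replicate h 1 ++ replicate L 0) L        ≡⟨ row-++-zeros (replicate h 1) L L ⟩
    row (replicate h 1) L                         ≡⟨ ones-row h L L<h ⟩
    1                                             ∎
    where
    open ≡-Reasoning
    N≡ : N ≡ length (replicate h 1) + L
    N≡ = +-comm L (length (replicate h 1))

fskew-ones-sum> : ∀ lam m → sum lam < m → fskew lam (replicate m 1) ≡ 0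
fskew-ones-sum> lam m lam<m with m ≤? length lam
... | no  m≰L = fskew-ones-> lam m (≰⇒> m≰L)
... | yes m≤L = trans (sym (sytCount-ones lam m m≤L)) (sytCount-sum> lam ones′ (subst (sum lam <_) (sym sum-ones′) lam<m))
  where
  ones′ = replicate m 1 ++ replicate (length lam ∸ m) 0
  sum-ones′ : sum ones′ ≡ m
  sum-ones′ = trans (sum-++-zeros (replicate m 1) (length lam ∸ m)) (sum-ones m)

minorShape-zeros : ∀ m L → m ≤ L → minorShape m (replicate (suc L) 0) ≡ replicate m 1 ++ replicate (L ∸ m) 0
minorShape-zeros zero    L       _         = refl
minorShape-zeros (suc m) (suc L) (s≤s m≤L) = cong (1 ∷_) (minorShape-zeros m L m≤L)

fshapeTerms : List ℕ → BinomialSum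
fshapeTerms ρ = tabulate (suc (length ρ)) (λ m → negOnePow m *ℤ + fskew ρ (replicate m 1)) (λ m → sum ρ ∸ m)

aitkenTerm-zeros : ∀ a ρ m → m ≤ length ρ →
  aitkenTerm (skewSize (a ∷ ρ) (replicate (suc (length ρ)) 0)) ρ (replicate (suc (length ρ)) 0) m
  ≡ (negOnePow m *ℤ + fskew ρ (replicate m 1)) *ℤ + ((a + sum ρ) C (sum ρ ∸ m))
aitkenTerm-zeros a ρ m m≤L = begin
  negOnePow m *ℤ + ((skewSize (a ∷ ρ) Z C skewSize ρ νₘ) * sytCount ρ νₘ)
    ≡⟨ cong (λ t → negOnePow m *ℤ + t) (cong₂ _*_ (cong₂ _C_ N≡ skew≡) f≡) ⟩
  negOnePow m *ℤ + ((x C (sum ρ ∸ m)) * f)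
    ≡⟨ cong (negOnePow m *ℤ_) (trans (cong +_ (*-comm (x C (sum ρ ∸ m)) f)) (ℤ.pos-* f _)) ⟩
  negOnePow m *ℤ (+ f *ℤ + (x C (sum ρ ∸ m)))
    ≡⟨ sym (ℤ.*-assoc (negOnePow m) (+ f) _) ⟩
  (negOnePow m *ℤ + f) *ℤ + (x C (sum ρ ∸ m)) ∎
  where
  open ≡-Reasoning
  L = length ρ
  x = a + sum ρ
  f = fskew ρ (replicate m 1)
  Z = replicate (suc L) 0
  νₘ = minorShape m Z
  νₘ≡ : νₘ ≡ replicate m 1 ++ replicate (L ∸ m) 0
  νₘ≡ = minorShape-zeros m L m≤L
  N≡ : skewSize (a ∷ ρ) Z ≡ x
  N≡ = cong (x ∸_) (sum-++-zeros [] (suc L))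
  skew≡ : skewSize ρ νₘ ≡ sum ρ ∸ m
  skew≡ = cong (sum ρ ∸_) (trans (cong sum νₘ≡) (trans (sum-++-zeros (replicate m 1) (L ∸ m)) (sum-ones m)))
  f≡ : sytCount ρ νₘ ≡ f
  f≡ = trans (cong (sytCount ρ) νₘ≡) (sytCount-ones ρ m m≤L)

-- f^{(a,ρ)} = Σ_m (−1)^m f^{ρ ∖ (1^m)} C(a + |ρ|, |ρ| − m): the Aitken expansion of f^{(a,ρ) ∖ ∅}.
fshape-binomial : ∀ a ρ → Decreasing (a ∷ ρ) → + fshape (a ∷ ρ) ≡ eval (fshapeTerms ρ) (a + sum ρ)
fshape-binomial a ρ lam↓ = begin
  + fshape (a ∷ ρ)
    ≡⟨ cong +_ (fskew-sytCount (a ∷ ρ) [] z≤n) ⟩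
  + sytCount (a ∷ ρ) Z
    ≡⟨ sytCount-aitken (skewSize (a ∷ ρ) Z) a ρ Z lam↓ Z↓ (length-replicate (suc L)) Z⊆ refl ⟩
  ∑ℤ (suc L) (aitkenTerm (skewSize (a ∷ ρ) Z) ρ Z)
    ≡⟨ ∑ℤ.∑-cong (suc L) (λ m m<n → aitkenTerm-zeros a ρ m (s≤s⁻¹ m<n)) ⟩
  ∑ℤ (suc L) (λ m → (negOnePow m *ℤ + fskew ρ (replicate m 1)) *ℤ + ((a + sum ρ) C (sum ρ ∸ m)))
    ≡⟨ sym (eval-tabulate (suc L) (λ m → negOnePow m *ℤ + fskew ρ (replicate m 1)) (sum ρ ∸_) (a + sum ρ)) ⟩
  eval (fshapeTerms ρ) (a + sum ρ) ∎
  where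
  open ≡-Reasoning
  L = length ρ
  Z = replicate (suc L) 0
  Z↓ : Decreasing Z
  Z↓ i = ≤-reflexive (trans (row-zeros (suc L) (suc i)) (sym (row-zeros (suc L) i)))
  Z⊆ : Z ⊆ (a ∷ ρ)
  Z⊆ i = subst (_≤ row (a ∷ ρ) i) (sym (row-zeros (suc L) i)) z≤n

coeff-fshapeTerms : ∀ lam h → h ≤ sum lam →
  coeff (fshapeTerms lam) (sum lam ∸ h) ≡ negOnePow h *ℤ + fskew lam (replicate h 1)
coeff-fshapeTerms lam h h≤ = trans (coeff-tabulate (suc L) c (sum lam ∸_) (sum lam ∸ h)) onlyH
  where
  L = length lam
  c : ℕ → ℤ
  c m = negOnePow m *ℤ + fskew lam (replicate m 1)
  others : ∀ m → m < suc L → m ≢ h → (if sum lam ∸ m ≡ᵇ sum lam ∸ h then c m else + 0) ≡ + 0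
  others m _ m≢h with m ≤? sum lam
  ... | yes m≤ rewrite ≡ᵇ≡false (m≢h ∘ ∸-cancelˡ-≡ m≤ h≤) = refl
  ... | no  m≰ = if-zero (sum lam ∸ m ≡ᵇ sum lam ∸ h)
                   (trans (cong (λ f → negOnePow m *ℤ + f) (fskew-ones-sum> lam m (≰⇒> m≰))) (ℤ.*-zeroʳ (negOnePow m)))
  onlyH : ∑ℤ (suc L) (λ m → if sum lam ∸ m ≡ᵇ sum lam ∸ h then c m else + 0) ≡ c h
  onlyH with h ≤? L
  ... | yes h≤L = trans (∑ℤ.∑-single (suc L) h (s≤s h≤L) others)
                        (cong (λ t → if t then c h else + 0) (≡ᵇ≡true {sum lam ∸ h} refl))
  ... | no  h≰L = trans (∑ℤ.∑-zero (suc L) (λ m m≤L → others m m≤L (λ { refl → h≰L (s≤s⁻¹ m≤L) })))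
                        (sym (trans (cong (λ f → negOnePow h *ℤ + f) (fskew-ones-> lam h (≰⇒> h≰L))) (ℤ.*-zeroʳ (negOnePow h))))

coeff-fshapeTerms-> : ∀ ρ D → sum ρ < D → coeff (fshapeTerms ρ) D ≡ + 0
coeff-fshapeTerms-> ρ D ρ<D = trans (coeff-tabulate (suc (length ρ)) (λ m → negOnePow m *ℤ + fskew ρ (replicate m 1)) (sum ρ ∸_) D)
  (∑ℤ.∑-zero (suc (length ρ)) (λ m _ → cong (λ t → if t then negOnePow m *ℤ + fskew ρ (replicate m 1) else + 0)
     (≡ᵇ≡false (λ eq → <-irrefl eq (≤-<-trans (m∸n≤m (sum ρ) m) ρ<D)))))

-- The Murnaghan–Nakayama rule for a long first row

sumℤ-++ : ∀ xs ys → sumℤ (xs ++ ys) ≡ sumℤ xs +ℤ sumℤ ys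
sumℤ-++ []       ys = sym (ℤ.+-identityˡ _)
sumℤ-++ (x ∷ xs) ys = trans (cong (x +ℤ_) (sumℤ-++ xs ys)) (sym (ℤ.+-assoc x (sumℤ xs) (sumℤ ys)))

sumℤ-concatMap : ∀ {A B : Set} (f : B → ℤ) (g : A → List B) xs →
  sumℤ (map f (concatMap g xs)) ≡ sumℤ (map (λ x → sumℤ (map f (g x))) xs)
sumℤ-concatMap f g []       = refl
sumℤ-concatMap f g (x ∷ xs) = begin
  sumℤ (map f (g x ++ concatMap g xs))               ≡⟨ cong sumℤ (map-++ f (g x) (concatMap g xs)) ⟩
  sumℤ (map f (g x) ++ map f (concatMap g xs))       ≡⟨ sumℤ-++ (map f (g x)) _ ⟩
  sumℤ (map f (g x)) +ℤ sumℤ (map f (concatMap g xs)) ≡⟨ cong (sumℤ (map f (g x)) +ℤ_) (sumℤ-concatMap f g xs) ⟩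
  sumℤ (map f (g x)) +ℤ sumℤ (map (λ x → sumℤ (map f (g x))) xs) ∎
  where open ≡-Reasoning

sumℤ-cong : ∀ {A : Set} {f g : A → ℤ} {xs} → All (λ x → f x ≡ g x) xs → sumℤ (map f xs) ≡ sumℤ (map g xs)
sumℤ-cong []           = refl
sumℤ-cong (f≡g ∷ f≗g) = cong₂ _+ℤ_ f≡g (sumℤ-cong f≗g)

sumℤ-zero : ∀ {A : Set} {f : A → ℤ} {xs} → All (λ x → f x ≡ + 0) xs → sumℤ (map f xs) ≡ + 0
sumℤ-zero []           = refl
sumℤ-zero (f≡0 ∷ f≗0) = cong₂ _+ℤ_ f≡0 (sumℤ-zero f≗0)

record SubShape (b : ℕ) (lam ρ : List ℕ) : Set where
  field
    length≡    : length ρ ≡ length lam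
    ⊆lam       : ρ ⊆ lam
    decreasing : Decreasing ρ
    head≤      : row ρ 0 ≤ b

subsB-SubShape : ∀ b lam → All (SubShape b lam) (subsB b lam)
subsB-SubShape b []        = record { length≡ = refl ; ⊆lam = λ _ → z≤n ; decreasing = λ _ → z≤n ; head≤ = z≤n } ∷ []
subsB-SubShape b (m ∷ lam) = All.concat⁺ (All.map⁺ (All.applyUpTo⁺₁ (λ i → i) (suc (b ⊓ m))
  (λ {x} x<1+b⊓m → All.map⁺ (All-map (extend x (s≤s⁻¹ x<1+b⊓m)) (subsB-SubShape x lam)))))
  where
  extend : ∀ x → x ≤ b ⊓ m → ∀ {ρ} → SubShape x lam ρ → SubShape b (m ∷ lam) (x ∷ ρ)
  extend x x≤ sub = record
    { length≡    = cong suc length≡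
    ; ⊆lam       = λ { zero → m≤n⊓o⇒m≤o b m x≤ ; (suc i) → ⊆lam i }
    ; decreasing = λ { zero → head≤ ; (suc i) → decreasing i }
    ; head≤      = m≤n⊓o⇒m≤n b m x≤ }
    where open SubShape sub

subsB-≥head : ∀ b lam → row lam 0 ≤ b → subsB b lam ≡ subs lam
subsB-≥head b []        _      = refl
subsB-≥head b (m ∷ lam) m≤b = cong (λ t → concatMap (λ x → map (x ∷_) (subsB x lam)) (upTo (suc t)))
  (trans (m≥n⇒m⊓n≡n m≤b) (sym (⊓-idem m)))

subsB-cons : ∀ b m lam (f : List ℕ → ℤ) →
  sumℤ (map f (subsB b (m ∷ lam))) ≡ ∑ℤ (suc (b ⊓ m)) (λ x → sumℤ (map (f ∘ (x ∷_)) (subsB x lam)))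
subsB-cons b m lam f = begin
  sumℤ (map f (concatMap (λ x → map (x ∷_) (subsB x lam)) (upTo (suc (b ⊓ m)))))
    ≡⟨ sumℤ-concatMap f (λ x → map (x ∷_) (subsB x lam)) (upTo (suc (b ⊓ m))) ⟩
  sumℤ (map (λ x → sumℤ (map f (map (x ∷_) (subsB x lam)))) (upTo (suc (b ⊓ m))))
    ≡⟨ ∑ℤ.foldr-applyUpTo (suc (b ⊓ m)) (λ x → sumℤ (map f (map (x ∷_) (subsB x lam)))) (λ i → i) ⟩
  ∑ℤ (suc (b ⊓ m)) (λ x → sumℤ (map f (map (x ∷_) (subsB x lam))))
    ≡⟨ ∑ℤ.∑-cong (suc (b ⊓ m)) (λ x _ → cong sumℤ (sym (map-∘ {g = f} {f = x ∷_} (subsB x lam)))) ⟩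
  ∑ℤ (suc (b ⊓ m)) (λ x → sumℤ (map (f ∘ (x ∷_)) (subsB x lam))) ∎
  where open ≡-Reasoning

-- Among the subshapes of lam only lam itself has the full size.
subsB-sum≡ : ∀ b lam (f : List ℕ → ℤ) → Decreasing lam → row lam 0 ≤ b →
  (∀ ρ → sum ρ ≢ sum lam → f ρ ≡ + 0) → sumℤ (map f (subsB b lam)) ≡ f lam
subsB-sum≡ b []        f _    _   _     = ℤ.+-identityʳ (f [])
subsB-sum≡ b (m ∷ lam) f lam↓ m≤b small = begin
  sumℤ (map f (subsB b (m ∷ lam)))
    ≡⟨ subsB-cons b m lam f ⟩
  ∑ℤ (suc (b ⊓ m)) (λ x → sumℤ (map (f ∘ (x ∷_)) (subsB x lam)))
    ≡⟨ cong (λ t → ∑ℤ (suc t) (λ x → sumℤ (map (f ∘ (x ∷_)) (subsB x lam)))) (m≥n⇒m⊓n≡n m≤b) ⟩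
  ∑ℤ (suc m) (λ x → sumℤ (map (f ∘ (x ∷_)) (subsB x lam)))
    ≡⟨ ∑ℤ.∑-single (suc m) m ≤-refl shorter ⟩
  sumℤ (map (f ∘ (m ∷_)) (subsB m lam))
    ≡⟨ subsB-sum≡ m lam (f ∘ (m ∷_)) (lam↓ ∘ suc) (lam↓ 0) (λ ρ ρ≢ → small (m ∷ ρ) (ρ≢ ∘ +-cancelˡ-≡ m _ _)) ⟩
  f (m ∷ lam) ∎
  where
  open ≡-Reasoning
  shorter : ∀ x → x < suc m → x ≢ m → sumℤ (map (f ∘ (x ∷_)) (subsB x lam)) ≡ + 0
  shorter x x≤m x≢m = sumℤ-zero (All-map (λ {ρ} sub → small (x ∷ ρ) (λ eq → <-irrefl eq
    (+-mono-<-≤ (≤∧≢⇒< (s≤s⁻¹ x≤m) x≢m) (sum-⊆ ρ lam (SubShape.length≡ sub) (SubShape.⊆lam sub)))))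
    (subsB-SubShape x lam))

Shorter : List ℕ → List ℕ → ℕ → Set
Shorter lam ρ i = row ρ i < row lam i

shorter? : ∀ lam ρ i → Dec (Shorter lam ρ i)
shorter? lam ρ i = row ρ i <? row lam i

stripRows-shift : ∀ x y lam ρ (f : ℕ → ℕ) n →
  filter (shorter? (y ∷ lam) (x ∷ ρ)) (applyUpTo (suc ∘ f) n) ≡ map suc (filter (shorter? lam ρ) (applyUpTo f n))
stripRows-shift x y lam ρ f zero    = refl
stripRows-shift x y lam ρ f (suc n) with shorter? lam ρ (f 0)
... | yes shorter = trans (filter-accept (shorter? (y ∷ lam) (x ∷ ρ)) {xs = applyUpTo (suc ∘ f ∘ suc) n} shorter)
  (trans (cong (suc (f 0) ∷_) (stripRows-shift x y lam ρ (f ∘ suc) n))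
         (cong (map suc) (sym (filter-accept (shorter? lam ρ) {xs = applyUpTo (f ∘ suc) n} shorter))))
... | no  longer  = trans (filter-reject (shorter? (y ∷ lam) (x ∷ ρ)) {x = suc (f 0)} {xs = applyUpTo (suc ∘ f ∘ suc) n} longer)
  (trans (stripRows-shift x y lam ρ (f ∘ suc) n)
         (cong (map suc) (sym (filter-reject (shorter? lam ρ) {x = f 0} {xs = applyUpTo (f ∘ suc) n} longer))))

stripRows-cons-< : ∀ a a′ lam ρ → a′ < a → stripRows (a ∷ lam) (a′ ∷ ρ) ≡ 0 ∷ map suc (stripRows lam ρ)
stripRows-cons-< a a′ lam ρ a′<a =
  trans (filter-accept (shorter? (a ∷ lam) (a′ ∷ ρ)) {xs = applyUpTo suc (length lam)} a′<a)
        (cong (0 ∷_) (stripRows-shift a′ a lam ρ (λ i → i) (length lam)))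

stripRows-cons-≡ : ∀ a lam ρ → stripRows (a ∷ lam) (a ∷ ρ) ≡ map suc (stripRows lam ρ)
stripRows-cons-≡ a lam ρ =
  trans (filter-reject (shorter? (a ∷ lam) (a ∷ ρ)) {x = 0} {xs = applyUpTo suc (length lam)} (<-irrefl refl))
        (stripRows-shift a a lam ρ (λ i → i) (length lam))

stripRows-firstRowOnly : ∀ a a′ lam → a′ < a → stripRows (a ∷ lam) (a′ ∷ lam) ≡ 0 ∷ []
stripRows-firstRowOnly a a′ lam a′<a = trans (stripRows-cons-< a a′ lam lam a′<a)
  (cong (λ is → 0 ∷ map suc is) (filter-none (shorter? lam lam) (All.applyUpTo⁺₂ (λ i → i) (length lam) (λ i → <-irrefl refl))))

stripOK-shift : ∀ x y lam ρ is → stripOK (x ∷ lam) (y ∷ ρ) (map suc is) ≡ stripOK lam ρ is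
stripOK-shift x y lam ρ []           = refl
stripOK-shift x y lam ρ (i ∷ [])     = refl
stripOK-shift x y lam ρ (i ∷ j ∷ is) =
  cong (λ t → (j ≡ᵇ suc i) ∧ (suc (row ρ i) ≡ᵇ row lam j) ∧ t) (stripOK-shift x y lam ρ (j ∷ is))

isBorderStrip-cons-≡ : ∀ a lam ρ → isBorderStrip (a ∷ lam) (a ∷ ρ) ≡ isBorderStrip lam ρ
isBorderStrip-cons-≡ a lam ρ =
  trans (cong (stripOK (a ∷ lam) (a ∷ ρ)) (stripRows-cons-≡ a lam ρ)) (stripOK-shift a a lam ρ (stripRows lam ρ))

height-cons-≡ : ∀ a lam ρ → height (a ∷ lam) (a ∷ ρ) ≡ height lam ρ
height-cons-≡ a lam ρ = cong (_∸ 1) (trans (cong length (stripRows-cons-≡ a lam ρ)) (length-map suc (stripRows lam ρ)))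

⊊-shorterRow : ∀ ρ lam → length ρ ≡ length lam → ρ ⊆ lam → sum ρ < sum lam →
  Σ ℕ (λ i → i < length lam × Shorter lam ρ i)
⊊-shorterRow (x ∷ ρ) (y ∷ lam) n≡ ρ⊆ ρ<lam with x <? y
... | yes x<y = 0 , z<s , x<y
... | no  x≮y with ⊊-shorterRow ρ lam (suc-injective n≡) (ρ⊆ ∘ suc)
                     (+-cancelˡ-< x (sum ρ) (sum lam) (<-≤-trans ρ<lam (+-monoˡ-≤ (sum lam) (≮⇒≥ x≮y))))
...   | i , i<n , shorter = suc i , s≤s i<n , shorter

-- A strip meeting row 0 and some lower row j must have lam j = a′ + 1, impossible when lam 0 ≤ a′.
isBorderStrip-disconnected : ∀ a a′ lam ρ → Decreasing lam → a′ < a → row lam 0 ≤ a′ →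
  length ρ ≡ length lam → ρ ⊆ lam → sum ρ < sum lam → isBorderStrip (a ∷ lam) (a′ ∷ ρ) ≡ false
isBorderStrip-disconnected a a′ lam ρ lam↓ a′<a head≤ n≡ ρ⊆ ρ<lam =
  trans (cong (stripOK (a ∷ lam) (a′ ∷ ρ)) (stripRows-cons-< a a′ lam ρ a′<a)) (notOK (stripRows lam ρ) nonempty)
  where
  nonempty : 0 < length (stripRows lam ρ)
  nonempty with ⊊-shorterRow ρ lam n≡ ρ⊆ ρ<lam
  ... | i , i<n , shorter = filter-some (shorter? lam ρ) (applyUpTo⁺ (λ i → i) shorter i<n)
  notOK : ∀ is → 0 < length is → stripOK (a ∷ lam) (a′ ∷ ρ) (0 ∷ map suc is) ≡ false
  notOK (j ∷ is) _ = trans (cong (λ b → (suc j ≡ᵇ 1) ∧ b ∧ stripOK (a ∷ lam) (a′ ∷ ρ) (suc j ∷ map suc is))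
                                 (≡ᵇ≡false (λ eq → <-irrefl (sym eq) (s≤s (≤-trans (Decreasing-head lam lam↓ j) head≤)))))
                           (∧-zeroʳ (suc j ≡ᵇ 1))

mnTerm : List ℕ → ℕ → List ℕ → ℤ
mnTerm mu r ρ = if (sum ρ + r ≡ᵇ sum mu) ∧ isBorderStrip mu ρ then negOnePow (height mu ρ) *ℤ (+ fshape ρ) else + 0

stripSign : ℕ → List ℕ → List ℕ → ℤ
stripSign r lam ρ = if (sum ρ + r ≡ᵇ sum lam) ∧ isBorderStrip lam ρ then negOnePow (height lam ρ) else + 0

chiCycle-firstRow : ∀ a lam r →
  chiCycle (a ∷ lam) r ≡ ∑ℤ (suc a) (λ a′ → sumℤ (map (mnTerm (a ∷ lam) r ∘ (a′ ∷_)) (subsB a′ lam)))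
chiCycle-firstRow a lam r = trans (subsB-cons a a lam (mnTerm (a ∷ lam) r))
  (cong (λ t → ∑ℤ (suc t) (λ a′ → sumℤ (map (mnTerm (a ∷ lam) r ∘ (a′ ∷_)) (subsB a′ lam)))) (⊓-idem a))

+-swapʳ : ∀ x y z → x + y + z ≡ x + z + y
+-swapʳ x y z = trans (+-assoc x y z) (trans (cong (_+_ x) (+-comm y z)) (sym (+-assoc x z y)))

mnTerm-fixedFirstRow : ∀ a lam r ρ → mnTerm (a ∷ lam) r (a ∷ ρ) ≡ stripSign r lam ρ *ℤ + fshape (a ∷ ρ)
mnTerm-fixedFirstRow a lam r ρ
  rewrite +-assoc a (sum ρ) r | +-≡ᵇ-+ a (sum ρ + r) (sum lam)
        | isBorderStrip-cons-≡ a lam ρ | height-cons-≡ a lam ρ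
  with (sum ρ + r ≡ᵇ sum lam) ∧ isBorderStrip lam ρ
... | true  = refl
... | false = sym (ℤ.*-zeroˡ (+ fshape (a ∷ ρ)))

mnTerm-firstRowStrip : ∀ a r lam → 0 < r → r ≤ a → mnTerm (a ∷ lam) r ((a ∸ r) ∷ lam) ≡ + fshape ((a ∸ r) ∷ lam)
mnTerm-firstRowStrip a r lam 0<r r≤a
  rewrite ≡ᵇ≡true (trans (+-swapʳ (a ∸ r) (sum lam) r) (cong (_+ sum lam) (m∸n+n≡m r≤a)))
        | stripRows-firstRowOnly a (a ∸ r) lam (∸-monoʳ-< 0<r r≤a) = ℤ.*-identityˡ (+ fshape ((a ∸ r) ∷ lam))

mnTerm-sum≢ : ∀ a r lam a′ ρ → a′ + sum ρ + r ≢ a + sum lam → mnTerm (a ∷ lam) r (a′ ∷ ρ) ≡ + 0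
mnTerm-sum≢ a r lam a′ ρ sum≢ rewrite ≡ᵇ≡false sum≢ = refl

otherFirstRow-bounds : ∀ a r a′ s t h → a′ + s + r ≡ a + t → a′ ≢ a ∸ r → s ≤ t → h + r ≤ a → s < t × h ≤ a′
otherFirstRow-bounds a r a′ s t h sum≡ a′≢ s≤t long = s<t , h≤a′
  where
  sum≡′ : (a′ + r) + s ≡ a + t
  sum≡′ = trans (sym (+-swapʳ a′ s r)) sum≡
  s<t : s < t
  s<t = ≤∧≢⇒< s≤t (λ s≡t → a′≢ (trans (sym (m+n∸n≡m a′ r))
          (cong (_∸ r) (+-cancelʳ-≡ t (a′ + r) a (trans (cong (_+_ (a′ + r)) (sym s≡t)) sum≡′)))))
  h≤a′ : h ≤ a′
  h≤a′ = +-cancelʳ-≤ r h a′ (≤-trans long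
           (+-cancelʳ-≤ t a (a′ + r) (≤-trans (≤-reflexive (sym sum≡′)) (+-monoʳ-≤ (a′ + r) s≤t))))

-- For lam 0 + r ≤ a, an r-strip of (a, lam) either lies in row 0 (a′ = a − r, ρ = lam) or misses it (a′ = a).
mnTerm-otherFirstRow : ∀ a r lam a′ ρ → Decreasing lam → row lam 0 + r ≤ a → a′ < a → a′ ≢ a ∸ r →
  SubShape a′ lam ρ → mnTerm (a ∷ lam) r (a′ ∷ ρ) ≡ + 0
mnTerm-otherFirstRow a r lam a′ ρ lam↓ long a′<a a′≢ sub with a′ + sum ρ + r ≟ a + sum lam
... | no  sum≢ = mnTerm-sum≢ a r lam a′ ρ sum≢
... | yes sum≡ with otherFirstRow-bounds a r a′ (sum ρ) (sum lam) (row lam 0) sum≡ a′≢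
                      (sum-⊆ ρ lam (SubShape.length≡ sub) (SubShape.⊆lam sub)) long
...   | ρ<lam , head≤a′ rewrite ≡ᵇ≡true sum≡
  | isBorderStrip-disconnected a a′ lam ρ lam↓ a′<a head≤a′ (SubShape.length≡ sub) (SubShape.⊆lam sub) ρ<lam = refl

chiCycle-longFirstRow : ∀ a r lam → Decreasing lam → 0 < r → row lam 0 + r ≤ a →
  chiCycle (a ∷ lam) r ≡ + fshape ((a ∸ r) ∷ lam) +ℤ sumℤ (map (λ ρ → stripSign r lam ρ *ℤ + fshape (a ∷ ρ)) (subs lam))
chiCycle-longFirstRow a r lam lam↓ 0<r long = begin
  chiCycle (a ∷ lam) r
    ≡⟨ chiCycle-firstRow a lam r ⟩
  ∑ℤ (suc a) S
    ≡⟨ ∑ℤ.∑-pair a (a ∸ r) a (∸-monoʳ-< 0<r r≤a) ≤-refl others ⟩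
  S (a ∸ r) +ℤ S a
    ≡⟨ cong₂ _+ℤ_ stripInFirstRow stripBelow ⟩
  + fshape ((a ∸ r) ∷ lam) +ℤ sumℤ (map (λ ρ → stripSign r lam ρ *ℤ + fshape (a ∷ ρ)) (subs lam)) ∎
  where
  open ≡-Reasoning
  S : ℕ → ℤ
  S a′ = sumℤ (map (mnTerm (a ∷ lam) r ∘ (a′ ∷_)) (subsB a′ lam))
  r≤a : r ≤ a
  r≤a = ≤-trans (m≤n+m r (row lam 0)) long
  head≤ : row lam 0 ≤ a ∸ r
  head≤ = ≤-trans (≤-reflexive (sym (m+n∸n≡m (row lam 0) r))) (∸-monoˡ-≤ r long)
  stripInFirstRow : S (a ∸ r) ≡ + fshape ((a ∸ r) ∷ lam)
  stripInFirstRow = trans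
    (subsB-sum≡ (a ∸ r) lam (mnTerm (a ∷ lam) r ∘ ((a ∸ r) ∷_)) lam↓ head≤ (λ ρ ρ≢ → mnTerm-sum≢ a r lam (a ∸ r) ρ
      (λ sum≡ → ρ≢ (+-cancelˡ-≡ a _ _ (trans (sym (trans (+-swapʳ (a ∸ r) (sum ρ) r) (cong (_+ sum ρ) (m∸n+n≡m r≤a)))) sum≡)))))
    (mnTerm-firstRowStrip a r lam 0<r r≤a)
  stripBelow : S a ≡ sumℤ (map (λ ρ → stripSign r lam ρ *ℤ + fshape (a ∷ ρ)) (subs lam))
  stripBelow = trans (cong (λ ρs → sumℤ (map (mnTerm (a ∷ lam) r ∘ (a ∷_)) ρs)) (subsB-≥head a lam (≤-trans (m≤m+n (row lam 0) r) long)))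
                     (cong sumℤ (map-cong (mnTerm-fixedFirstRow a lam r) (subs lam)))
  others : ∀ a′ → a′ < suc a → a′ ≢ a ∸ r → a′ ≢ a → S a′ ≡ + 0
  others a′ a′≤a a′≢ a′≢a = sumℤ-zero (All-map (λ {ρ} → mnTerm-otherFirstRow a r lam a′ ρ lam↓ long (≤∧≢⇒< (s≤s⁻¹ a′≤a) a′≢a) a′≢)
                                                (subsB-SubShape a′ lam))

negOnePow-cancel : ∀ h {u v} → negOnePow h *ℤ u ≡ negOnePow h *ℤ v → u ≡ v
negOnePow-cancel zero    {u} {v} eq = trans (sym (ℤ.*-identityˡ u)) (trans eq (ℤ.*-identityˡ v))
negOnePow-cancel (suc h) {u} {v} eq = negOnePow-cancel h (ℤ.neg-injective
  (trans (ℤ.neg-distribˡ-* (negOnePow h) u) (trans eq (sym (ℤ.neg-distribˡ-* (negOnePow h) v)))))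

expansionTerms : ℕ → (ℕ → ℤ) → BinomialSum
expansionTerms k b = tabulate (suc k) (λ j → negOnePow j *ℤ b j) (k ∸_)

binomExpansion-eval : ∀ k r b n → binomExpansion k r b n ≡ eval (expansionTerms k b) (n ∸ r)
binomExpansion-eval k r b n = begin
  binomExpansion k r b n
    ≡⟨ ∑ℤ.foldr-applyUpTo (suc k) (λ j → negOnePow j *ℤ (b j *ℤ + ((n ∸ r) C (k ∸ j)))) (λ j → j) ⟩
  ∑ℤ (suc k) (λ j → negOnePow j *ℤ (b j *ℤ + ((n ∸ r) C (k ∸ j))))
    ≡⟨ ∑ℤ.∑-cong (suc k) (λ j _ → sym (ℤ.*-assoc (negOnePow j) (b j) (+ ((n ∸ r) C (k ∸ j))))) ⟩
  ∑ℤ (suc k) (λ j → negOnePow j *ℤ b j *ℤ + ((n ∸ r) C (k ∸ j)))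
    ≡⟨ sym (eval-tabulate (suc k) (λ j → negOnePow j *ℤ b j) (k ∸_) (n ∸ r)) ⟩
  eval (expansionTerms k b) (n ∸ r) ∎
  where open ≡-Reasoning

coeff-expansionTerms : ∀ k b h → h ≤ k → coeff (expansionTerms k b) (k ∸ h) ≡ negOnePow h *ℤ b h
coeff-expansionTerms k b h h≤k = trans (coeff-tabulate (suc k) (λ j → negOnePow j *ℤ b j) (k ∸_) (k ∸ h))
  (trans (∑ℤ.∑-single (suc k) h (s≤s h≤k) others)
         (cong (λ t → if t then negOnePow h *ℤ b h else + 0) (≡ᵇ≡true {k ∸ h} refl)))
  where
  others : ∀ j → j < suc k → j ≢ h → (if k ∸ j ≡ᵇ k ∸ h then negOnePow j *ℤ b j else + 0) ≡ + 0
  others j j≤k j≢h rewrite ≡ᵇ≡false (j≢h ∘ ∸-cancelˡ-≡ (s≤s⁻¹ j≤k) h≤k) = refl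

chiTerms : ℕ → List ℕ → BinomialSum
chiTerms r lam = fshapeTerms lam ++ concatMap (λ ρ → scale (stripSign r lam ρ) (fshapeTerms ρ)) (subs lam)

stripSign-* : ∀ r lam ρ {x y} → (sum ρ + r ≡ sum lam → x ≡ y) → stripSign r lam ρ *ℤ x ≡ stripSign r lam ρ *ℤ y
stripSign-* r lam ρ x≡y with sum ρ + r ≟ sum lam
... | yes size≡ = cong (stripSign r lam ρ *ℤ_) (x≡y size≡)
... | no  size≢ rewrite ≡ᵇ≡false size≢ = refl

stripTerm-binomial : ∀ r lam a ρ x → Decreasing (a ∷ ρ) → a + sum lam ≡ x + r →
  stripSign r lam ρ *ℤ + fshape (a ∷ ρ) ≡ eval (scale (stripSign r lam ρ) (fshapeTerms ρ)) x
stripTerm-binomial r lam a ρ x ρ↓ size≡ = trans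
  (stripSign-* r lam ρ (λ strip≡ → trans (fshape-binomial a ρ ρ↓) (cong (eval (fshapeTerms ρ)) (+-cancelʳ-≡ r (a + sum ρ) x
    (trans (+-assoc a (sum ρ) r) (trans (cong (_+_ a) strip≡) size≡))))))
  (sym (eval-scale (stripSign r lam ρ) (fshapeTerms ρ) x))

chiCycle-binomial : ∀ lam r d → Decreasing lam → 0 < r → row lam 0 ≤ d →
  chiCycle ((d + r) ∷ lam) r ≡ eval (chiTerms r lam) (d + sum lam)
chiCycle-binomial lam r d lam↓ 0<r head≤d = begin
  chiCycle ((d + r) ∷ lam) r
    ≡⟨ chiCycle-longFirstRow (d + r) r lam lam↓ 0<r (+-monoˡ-≤ r head≤d) ⟩
  + fshape ((d + r ∸ r) ∷ lam) +ℤ sumℤ (map (λ ρ → stripSign r lam ρ *ℤ + fshape ((d + r) ∷ ρ)) (subs lam))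
    ≡⟨ cong₂ _+ℤ_ firstRow strips ⟩
  eval (fshapeTerms lam) x +ℤ eval (concatMap (λ ρ → scale (stripSign r lam ρ) (fshapeTerms ρ)) (subs lam)) x
    ≡⟨ sym (eval-++ (fshapeTerms lam) _ x) ⟩
  eval (chiTerms r lam) x ∎
  where
  open ≡-Reasoning
  x = d + sum lam
  firstRow : + fshape ((d + r ∸ r) ∷ lam) ≡ eval (fshapeTerms lam) x
  firstRow = trans (cong (λ a → + fshape (a ∷ lam)) (m+n∸n≡m d r)) (fshape-binomial d lam (Decreasing-cons d lam lam↓ head≤d))
  strip : ∀ ρ → SubShape (row lam 0) lam ρ →
    stripSign r lam ρ *ℤ + fshape ((d + r) ∷ ρ) ≡ eval (scale (stripSign r lam ρ) (fshapeTerms ρ)) x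
  strip ρ sub = stripTerm-binomial r lam (d + r) ρ x
    (Decreasing-cons (d + r) ρ (SubShape.decreasing sub) (≤-trans (SubShape.head≤ sub) (≤-trans head≤d (m≤m+n d r))))
    (+-swapʳ d r (sum lam))
  strips : sumℤ (map (λ ρ → stripSign r lam ρ *ℤ + fshape ((d + r) ∷ ρ)) (subs lam))
           ≡ eval (concatMap (λ ρ → scale (stripSign r lam ρ) (fshapeTerms ρ)) (subs lam)) x
  strips = trans (sumℤ-cong (All-map (λ {ρ} → strip ρ) (subsB-SubShape (row lam 0) lam)))
                 (sym (eval-concatMap (λ ρ → scale (stripSign r lam ρ) (fshapeTerms ρ)) (subs lam) x))

chiCycle-binomial-≥ : ∀ k lam r x → Decreasing lam → sum lam ≡ k → 0 < r → k + row lam 0 ≤ x →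
  chiCycle ((x + r ∸ k) ∷ lam) r ≡ eval (chiTerms r lam) x
chiCycle-binomial-≥ k lam r x lam↓ refl 0<r x≥ = begin
  chiCycle ((x + r ∸ k) ∷ lam) r        ≡⟨ cong (λ a → chiCycle (a ∷ lam) r) a≡ ⟩
  chiCycle ((d + r) ∷ lam) r            ≡⟨ chiCycle-binomial lam r d lam↓ 0<r (subst (_≤ d) (m+n∸m≡n k (row lam 0)) (∸-monoˡ-≤ k x≥)) ⟩
  eval (chiTerms r lam) (d + k)         ≡⟨ cong (eval (chiTerms r lam)) x≡ ⟩
  eval (chiTerms r lam) x               ∎
  where
  open ≡-Reasoning
  d = x ∸ k
  x≡ : d + k ≡ x
  x≡ = m∸n+n≡m (≤-trans (m≤m+n k (row lam 0)) x≥)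
  a≡ : x + r ∸ k ≡ d + r
  a≡ = trans (cong (λ t → t + r ∸ k) (sym x≡)) (trans (cong (_∸ k) (+-swapʳ d k r)) (m+n∸n≡m (d + r) k))

-- The strips below row 0 contribute only binomials C(x, d) with d ≤ |lam| − r.
coeff-chiTerms : ∀ lam r h → h ≤ sum lam → h < r →
  coeff (chiTerms r lam) (sum lam ∸ h) ≡ negOnePow h *ℤ + fskew lam (replicate h 1)
coeff-chiTerms lam r h h≤ h<r = begin
  coeff (chiTerms r lam) D
    ≡⟨ coeff-++ (fshapeTerms lam) (concatMap (λ ρ → scale (stripSign r lam ρ) (fshapeTerms ρ)) (subs lam)) D ⟩
  coeff (fshapeTerms lam) D +ℤ coeff (concatMap (λ ρ → scale (stripSign r lam ρ) (fshapeTerms ρ)) (subs lam)) D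
    ≡⟨ cong₂ _+ℤ_ (coeff-fshapeTerms lam h h≤) strips ⟩
  negOnePow h *ℤ + fskew lam (replicate h 1) +ℤ + 0
    ≡⟨ ℤ.+-identityʳ _ ⟩
  negOnePow h *ℤ + fskew lam (replicate h 1) ∎
  where
  open ≡-Reasoning
  D = sum lam ∸ h
  strip : ∀ ρ → coeff (scale (stripSign r lam ρ) (fshapeTerms ρ)) D ≡ + 0
  strip ρ = trans (coeff-scale (stripSign r lam ρ) (fshapeTerms ρ) D)
    (trans (stripSign-* r lam ρ (λ size≡ → coeff-fshapeTerms-> ρ D (+-cancelʳ-< r (sum ρ) D
             (subst (_< D + r) (trans (m∸n+n≡m h≤) (sym size≡)) (+-monoʳ-< D h<r)))))
           (ℤ.*-zeroʳ (stripSign r lam ρ)))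
  strips : coeff (concatMap (λ ρ → scale (stripSign r lam ρ) (fshapeTerms ρ)) (subs lam)) D ≡ + 0
  strips = trans (coeff-concatMap (λ ρ → scale (stripSign r lam ρ) (fshapeTerms ρ)) (subs lam) D)
                 (sumℤ-zero (universal strip (subs lam)))

corollary3p9 : (k : ℕ) (lam : List ℕ) → lam ⊢ k → (h : ℕ) → h ≤ k →
    (r : ℕ) → 2 ≤ r → h < r → (b : ℕ → ℤ) →
    (∀ (n : ℕ) → k + row lam 0 ≤ n → r ≤ n →
      chiCycle ((n ∸ k) ∷ lam) r ≡ binomExpansion k r b n) →
    b h ≡ + fskew lam (replicate h 1)
corollary3p9 k lam ((linked , _) , sum≡k) h h≤k r 2≤r h<r b hyp = negOnePow-cancel h (begin
  negOnePow h *ℤ b h                          ≡⟨ sym (coeff-expansionTerms k b h h≤k) ⟩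
  coeff (expansionTerms k b) (k ∸ h)          ≡⟨ coeff-unique (expansionTerms k b) (chiTerms r lam) (k + row lam 0) agree (k ∸ h) ⟩
  coeff (chiTerms r lam) (k ∸ h)              ≡⟨ cong (λ s → coeff (chiTerms r lam) (s ∸ h)) (sym sum≡k) ⟩
  coeff (chiTerms r lam) (sum lam ∸ h)        ≡⟨ coeff-chiTerms lam r h (subst (h ≤_) (sym sum≡k) h≤k) h<r ⟩
  negOnePow h *ℤ + fskew lam (replicate h 1)  ∎)
  where
  open ≡-Reasoning
  agree : ∀ x → k + row lam 0 ≤ x → eval (expansionTerms k b) x ≡ eval (chiTerms r lam) x
  agree x x≥ = begin
    eval (expansionTerms k b) x            ≡⟨ cong (eval (expansionTerms k b)) (sym (m+n∸n≡m x r)) ⟩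
    eval (expansionTerms k b) (x + r ∸ r)  ≡⟨ sym (binomExpansion-eval k r b (x + r)) ⟩
    binomExpansion k r b (x + r)           ≡⟨ sym (hyp (x + r) (≤-trans x≥ (m≤m+n x r)) (m≤n+m r x)) ⟩
    chiCycle ((x + r ∸ k) ∷ lam) r         ≡⟨ chiCycle-binomial-≥ k lam r x (Linked⇒Decreasing linked) sum≡k (<-≤-trans z<s 2≤r) x≥ ⟩
    eval (chiTerms r lam) x                ∎
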